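{- Let $G$ be a strongly regular graph with parameters $(1911,270,105,27)$. Assume $C_1$ and $C_2$ are cliques of $G$ with $V(C_1)\neq V(C_2)$, each of order at least $29$, such that $|V(C_1)\cap V(C_2)|\geqslant 22$. Then one of the following holds: (1) there is at least one vertex $z$ in the symmetric difference $S=(V(C_1)\setminus V(C_2))\cup(V(C_2)\setminus V(C_1))$ which is adjacent to all vertices of $S\setminus\{z\}$; (2) $|V(C_1)\cap V(C_2)|=27$, and $C_1$ and $C_2$ are both maximal cliques, each of order $29$.
   Context: A strongly regular graph with parameters $(n,k,\lambda,\mu)$ is a finite simple $k$-regular graph on $n$ vertices in which any two distinct adjacent vertices have exactly $\lambda$ common neighbours and any two distinct non-adjacent vertices have exactly $\mu$ common neighbours. A clique is a set of pairwise adjacent vertices (a complete subgraph); it is maximal if it is not contained in a larger clique. -}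

module Defs where

open import Data.Nat using (ℕ)
open import Data.Fin using (Fin)
open import Data.Fin.Subset using (Subset; _∈_; _∩_; _∪_; _─_; _⊆_; ∣_∣)
open import Data.Vec using (tabulate)
open import Relation.Nullary using (Dec; ¬_; does)
open import Relation.Binary.PropositionalEquality using (_≡_; _≢_)

record SimpleGraph (n : ℕ) : Set₁ where
  field
    Adj    : Fin n → Fin n → Set
    Adj?   : ∀ u v → Dec (Adj u v)
    sym    : ∀ {u v} → Adj u v → Adj v u
    irrefl : ∀ {u} → ¬ Adj u u

module _ {n : ℕ} (G : SimpleGraph n) where
  open SimpleGraph G

  N : Fin n → Subset n
  N v = tabulate (λ w → does (Adj? v w))

  record IsSRG (k λ′ μ : ℕ) : Set where
    field
      regular     : ∀ v → ∣ N v ∣ ≡ k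
      adjCommon   : ∀ u v → u ≢ v → Adj u v → ∣ N u ∩ N v ∣ ≡ λ′
      nonadjCommon : ∀ u v → u ≢ v → ¬ Adj u v → ∣ N u ∩ N v ∣ ≡ μ

  IsClique : Subset n → Set
  IsClique C = ∀ {x y} → x ∈ C → y ∈ C → x ≢ y → Adj x y

  IsMaximalClique : Subset n → Set
  IsMaximalClique C = IsClique C × (∀ D → IsClique D → C ⊆ D → D ≡ C)
    where open import Data.Product using (_×_)

  SymDiff : Subset n → Subset n → Subset n
  SymDiff A B = (A ─ B) ∪ (B ─ A)

{-# OPTIONS --safe #-}
-- Write A = C₁ ∖ C₂, B = C₂ ∖ C₁ and I = C₁ ∩ C₂, with m = |I|, p = |A|, q = |B|, and let
-- E be the number of edges between A and B. If no vertex of the symmetric difference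
-- dominates it, every vertex of A has a non-neighbour in B and vice versa; counting the
-- μ = 27 common neighbours of such non-adjacent pairs bounds E in terms of m, p, q.
-- On the other hand A + 3I is positive semidefinite with constant row sums 273, so
-- (∑ w)² ≤ 7 · wᵀ(A + 3I)w for every integer weighting w of the vertices; for weightings
-- constant on A, B and I this is an integral quadratic inequality in m, p, q and E.
-- A finite check leaves only (m, p, q) = (27, 2, 2) and (22, 7, 7), and a sharper count
-- refutes the second. Maximality follows by applying the same result to the configuration
-- enlarged by an extending vertex.
module Submission where

open import Defs
open import Data.Bool using (Bool; true; false; _∧_; T)
open import Data.Bool.Properties using (T-∧)
open import Function.Bundles using (Equivalence)
open import Data.Empty using (⊥; ⊥-elim)
open import Data.Fin using (Fin; zero; suc)
open import Data.Fin.Properties using (_≟_; all?; any?; ¬∀⟶∃¬)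
open import Data.Fin.Subset using (Subset; _∈_; _∉_; _⊆_; _∩_; _∪_; _─_; ⁅_⁆; ∣_∣; Empty; Nonempty; inside; outside)
open import Data.Fin.Subset.Properties using (_∈?_; drop-there; x∈p∩q⁺; x∈p∩q⁻; x∈p∧x∉q⇒x∈p─q; x∈⁅x⁆; x∈⁅y⁆⇒x≡y; x∈p∪q⁺; x∈p∪q⁻; Empty-unique; ∣⊥∣≡0; nonempty?; ∣⁅x⁆∣≡1; ∣p∩q∣≤∣q∣; p⊆q⇒∣p∣≤∣q∣; ⊆-antisym; ∩-idem; ∩-comm; ∪-comm)
open import Data.Integer as ℤ using (ℤ; +_; -_; _+_; _*_; _-_; _≤_; _<_; 0ℤ; 1ℤ)
import Data.Integer.Properties as ℤP
open import Data.Integer.Tactic.RingSolver using (solve-∀)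
open import Data.Nat as ℕ using (ℕ; zero; suc; _∸_; _≥_)
import Data.Nat.Properties as ℕP
open import Data.Nat.DivMod using (_/_)
open import Data.Product using (_×_; _,_; proj₁; proj₂; ∃-syntax)
open import Data.Sum using (_⊎_; inj₁; inj₂; [_,_]′)
open import Data.Vec using ([]; _∷_; lookup; here; there)
open import Data.Vec.Properties using (lookup-zipWith; lookup∘tabulate; []=⇒lookup; lookup⇒[]=)
open import Function using (_∘_)
open import Relation.Binary.PropositionalEquality
open import Relation.Nullary using (Dec; ¬_; does; yes; no; isYes)
open import Relation.Nullary.Decidable using (dec-true; dec-false; map′; _×-dec_; _⊎-dec_; _→-dec_; toWitness)
open import Algebra.Properties.Semiring.Sum ℤP.+-*-semiring using (sum; sum-syntax; sum-cong-≗; ∑-distrib-+; ∑-comm; *-distribˡ-sum; sum-replicate-zero)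

-- Integers and finite sums
≤-from-gap : ∀ {i j} d → 0ℤ ≤ d → j - i ≡ d → i ≤ j
≤-from-gap d 0≤d refl = ℤP.0≤i-j⇒j≤i 0≤d

*-nonneg : ∀ {i j} → 0ℤ ≤ i → 0ℤ ≤ j → 0ℤ ≤ i * j
*-nonneg {+ a} {+ b} _ _ = subst (0ℤ ≤_) (ℤP.pos-* a b) (ℤ.+≤+ ℕ.z≤n)

square-nonneg : ∀ i → 0ℤ ≤ i * i
square-nonneg (+ a) = *-nonneg {+ a} {+ a} (ℤ.+≤+ ℕ.z≤n) (ℤ.+≤+ ℕ.z≤n)
square-nonneg ℤ.-[1+ a ] = ℤ.+≤+ ℕ.z≤n

ind : Bool → ℤ
ind true = 1ℤ
ind false = 0ℤ

ind-nonneg : ∀ b → 0ℤ ≤ ind b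
ind-nonneg true = ℤ.+≤+ ℕ.z≤n
ind-nonneg false = ℤ.+≤+ ℕ.z≤n

ind-idem : ∀ b → ind b * ind b ≡ ind b
ind-idem true = refl
ind-idem false = refl

ind-∧ : ∀ a b → ind (a ∧ b) ≡ ind a * ind b
ind-∧ true b = sym (ℤP.*-identityˡ (ind b))
ind-∧ false b = refl

∑-distribˡ-* : ∀ {n} c (f : Fin n → ℤ) → ∑[ i < n ] (c * f i) ≡ c * sum f
∑-distribˡ-* c f = sym (*-distribˡ-sum c f)

∑-distrib-+₃ : ∀ {n} (f g h : Fin n → ℤ) → ∑[ i < n ] (f i + g i + h i) ≡ sum f + sum g + sum h
∑-distrib-+₃ f g h = trans (∑-distrib-+ (λ i → f i + g i) h) (cong (_+ sum h) (∑-distrib-+ f g))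

∑-distrib-- : ∀ {n} (f g : Fin n → ℤ) → ∑[ i < n ] (f i - g i) ≡ sum f - sum g
∑-distrib-- {zero} f g = refl
∑-distrib-- {suc n} f g = trans (cong (_+_ (f zero - g zero)) (∑-distrib-- (f ∘ suc) (g ∘ suc)))
  (interchange (f zero) (g zero) (sum (f ∘ suc)) (sum (g ∘ suc)))
  where
  interchange : ∀ a b c d → a - b + (c - d) ≡ a + c - (b + d)
  interchange = solve-∀

∑*∑ : ∀ {n} (f g : Fin n → ℤ) → sum f * sum g ≡ ∑[ i < n ] ∑[ j < n ] (f i * g j)
∑*∑ {n} f g = begin
  sum f * sum g                     ≡⟨ ℤP.*-comm (sum f) (sum g) ⟩
  sum g * sum f                     ≡⟨ ∑-distribˡ-* (sum g) f ⟨
  ∑[ i < n ] (sum g * f i)          ≡⟨ sum-cong-≗ (λ i → trans (ℤP.*-comm (sum g) (f i)) (sym (∑-distribˡ-* (f i) g))) ⟩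
  ∑[ i < n ] ∑[ j < n ] (f i * g j) ∎
  where open ≡-Reasoning

∑-const : ∀ n c → ∑[ i < n ] c ≡ + n * c
∑-const zero c = refl
∑-const (suc n) c = begin
  c + ∑[ i < n ] c  ≡⟨ cong (_+_ c) (∑-const n c) ⟩
  c + + n * c       ≡⟨ distrib c (+ n) ⟩
  (1ℤ + + n) * c    ∎
  where
  open ≡-Reasoning
  distrib : ∀ c k → c + k * c ≡ (1ℤ + k) * c
  distrib = solve-∀

∑-mono-≤ : ∀ {n} {f g : Fin n → ℤ} → (∀ i → f i ≤ g i) → sum f ≤ sum g
∑-mono-≤ {zero} f≤g = ℤP.≤-refl
∑-mono-≤ {suc n} f≤g = ℤP.+-mono-≤ (f≤g zero) (∑-mono-≤ (f≤g ∘ suc))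

∑-nonneg : ∀ {n} {f : Fin n → ℤ} → (∀ i → 0ℤ ≤ f i) → 0ℤ ≤ sum f
∑-nonneg {n} {f} 0≤f = subst (_≤ sum f) (sum-replicate-zero n) (∑-mono-≤ {f = λ _ → 0ℤ} 0≤f)

δ : ∀ {n} → Fin n → Fin n → ℤ
δ i j = ind (does (i ≟ j))

δ-sym : ∀ {n} (i j : Fin n) → δ i j ≡ δ j i
δ-sym i j with i ≟ j | j ≟ i
... | yes _ | yes _ = refl
... | no _ | no _ = refl
... | yes i≡j | no j≢i = ⊥-elim (j≢i (sym i≡j))
... | no i≢j | yes j≡i = ⊥-elim (i≢j (sym j≡i))

∑-δ : ∀ {n} (i : Fin n) (f : Fin n → ℤ) → ∑[ j < n ] (δ i j * f j) ≡ f i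
∑-δ {suc n} zero f = begin
  1ℤ * f zero + ∑[ j < n ] 0ℤ  ≡⟨ cong (_+_ (1ℤ * f zero)) (sum-replicate-zero n) ⟩
  1ℤ * f zero + 0ℤ             ≡⟨ unit (f zero) ⟩
  f zero                       ∎
  where
  open ≡-Reasoning
  unit : ∀ x → 1ℤ * x + 0ℤ ≡ x
  unit = solve-∀
∑-δ {suc n} (suc i) f = trans (ℤP.+-identityˡ _) (∑-δ i (f ∘ suc))

bilinear : ∀ {n} → (Fin n → Fin n → ℤ) → (Fin n → ℤ) → (Fin n → ℤ) → ℤ
bilinear {n} K f g = ∑[ s < n ] (f s * ∑[ t < n ] (K s t * g t))

bilinear-sym : ∀ {n} {K : Fin n → Fin n → ℤ} → (∀ s t → K s t ≡ K t s) →
               ∀ f g → bilinear K f g ≡ bilinear K g f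
bilinear-sym {n} {K} K-sym f g = begin
  ∑[ s < n ] (f s * ∑[ t < n ] (K s t * g t))    ≡⟨ sum-cong-≗ (λ s → ∑-distribˡ-* (f s) (λ t → K s t * g t)) ⟨
  ∑[ s < n ] ∑[ t < n ] (f s * (K s t * g t))    ≡⟨ ∑-comm (λ s t → f s * (K s t * g t)) ⟩
  ∑[ t < n ] ∑[ s < n ] (f s * (K s t * g t))    ≡⟨ sum-cong-≗ (λ t → sum-cong-≗ (λ s → exchange s t)) ⟩
  ∑[ t < n ] ∑[ s < n ] (g t * (K t s * f s))    ≡⟨ sum-cong-≗ (λ t → ∑-distribˡ-* (g t) (λ s → K t s * f s)) ⟩
  ∑[ t < n ] (g t * ∑[ s < n ] (K t s * f s))    ∎
  where
  open ≡-Reasoning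
  rearrange : ∀ x y k → x * (k * y) ≡ y * (k * x)
  rearrange = solve-∀
  exchange : ∀ s t → f s * (K s t * g t) ≡ g t * (K t s * f s)
  exchange s t = trans (rearrange (f s) (g t) (K s t)) (cong (λ k → g t * (k * f s)) (K-sym s t))

bilinear-linearˡ : ∀ {n} (K : Fin n → Fin n → ℤ) x y z (f g h k : Fin n → ℤ) →
  bilinear K (λ s → x * f s + y * g s + z * h s) k ≡ x * bilinear K f k + y * bilinear K g k + z * bilinear K h k
bilinear-linearˡ {n} K x y z f g h k = begin
  ∑[ s < n ] ((x * f s + y * g s + z * h s) * Kk s)                   ≡⟨ sum-cong-≗ (λ s → distrib x y z (f s) (g s) (h s) (Kk s)) ⟩
  ∑[ s < n ] (x * (f s * Kk s) + y * (g s * Kk s) + z * (h s * Kk s)) ≡⟨ ∑-distrib-+ (λ s → x * (f s * Kk s) + y * (g s * Kk s)) (λ s → z * (h s * Kk s)) ⟩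
  ∑[ s < n ] (x * (f s * Kk s) + y * (g s * Kk s)) + ∑[ s < n ] (z * (h s * Kk s))
    ≡⟨ cong₂ _+_ (∑-distrib-+ (λ s → x * (f s * Kk s)) (λ s → y * (g s * Kk s))) (∑-distribˡ-* z (λ s → h s * Kk s)) ⟩
  ∑[ s < n ] (x * (f s * Kk s)) + ∑[ s < n ] (y * (g s * Kk s)) + z * bilinear K h k
    ≡⟨ cong₂ (λ a b → a + b + z * bilinear K h k) (∑-distribˡ-* x (λ s → f s * Kk s)) (∑-distribˡ-* y (λ s → g s * Kk s)) ⟩
  x * bilinear K f k + y * bilinear K g k + z * bilinear K h k         ∎
  where
  open ≡-Reasoning
  Kk : Fin n → ℤ
  Kk s = ∑[ t < n ] (K s t * k t)
  distrib : ∀ x y z a b c m → (x * a + y * b + z * c) * m ≡ x * (a * m) + y * (b * m) + z * (c * m)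
  distrib = solve-∀

-- Subsets and their indicator functions
∈─⁻ : ∀ {n} (p q : Subset n) {x} → x ∈ p ─ q → x ∈ p × x ∉ q
∈─⁻ (s ∷ p) (outside ∷ q) {zero} here = here , λ ()
∈─⁻ (s ∷ p) (t ∷ q) {suc x} (there x∈p─q) with ∈─⁻ p q x∈p─q
... | x∈p , x∉q = there x∈p , x∉q ∘ drop-there

module _ {n : ℕ} where

  Empty∩⇒∉ : ∀ {X Y : Subset n} {v} → Empty (X ∩ Y) → v ∈ X → v ∉ Y
  Empty∩⇒∉ X∩Y-empty v∈X v∈Y = X∩Y-empty (_ , x∈p∩q⁺ (v∈X , v∈Y))

  Empty∩-sym : ∀ {X Y : Subset n} → Empty (X ∩ Y) → Empty (Y ∩ X)
  Empty∩-sym {X} {Y} X∩Y-empty (v , v∈Y∩X) with x∈p∩q⁻ Y X v∈Y∩X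
  ... | v∈Y , v∈X = Empty∩⇒∉ X∩Y-empty v∈X v∈Y

  ∣Empty∣≡0 : ∀ {X : Subset n} → Empty X → ∣ X ∣ ≡ 0
  ∣Empty∣≡0 X-empty = trans (cong ∣_∣ (Empty-unique X-empty)) (∣⊥∣≡0 n)

  Empty─⇒⊆ : ∀ {X Y : Subset n} → Empty (X ─ Y) → X ⊆ Y
  Empty─⇒⊆ {X} {Y} X─Y-empty {v} v∈X with v ∈? Y
  ... | yes v∈Y = v∈Y
  ... | no v∉Y = ⊥-elim (X─Y-empty (v , x∈p∧x∉q⇒x∈p─q v∈X v∉Y))

  Empty∪⁅⁆∩ : ∀ {X Y : Subset n} {v} → Empty (X ∩ Y) → v ∉ Y → Empty ((X ∪ ⁅ v ⁆) ∩ Y)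
  Empty∪⁅⁆∩ {X} {Y} {v} X∩Y-empty v∉Y (u , u∈) with x∈p∩q⁻ (X ∪ ⁅ v ⁆) Y u∈
  ... | u∈X∪v , u∈Y with x∈p∪q⁻ X ⁅ v ⁆ u∈X∪v
  ...   | inj₁ u∈X = Empty∩⇒∉ X∩Y-empty u∈X u∈Y
  ...   | inj₂ u∈⁅v⁆ = v∉Y (subst (_∈ Y) (x∈⁅y⁆⇒x≡y v u∈⁅v⁆) u∈Y)

  ∪-⊆ : ∀ {X Y Z : Subset n} → X ⊆ Z → Y ⊆ Z → X ∪ Y ⊆ Z
  ∪-⊆ {X} {Y} X⊆Z Y⊆Z v∈X∪Y = [ X⊆Z , Y⊆Z ]′ (x∈p∪q⁻ X Y v∈X∪Y)

  χ : Subset n → Fin n → ℤ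
  χ U v = ind (lookup U v)

  χ-∈ : ∀ {U v} → v ∈ U → χ U v ≡ 1ℤ
  χ-∈ v∈U = cong ind ([]=⇒lookup v∈U)

  χ-∉ : ∀ {U v} → v ∉ U → χ U v ≡ 0ℤ
  χ-∉ {U} {v} v∉U with lookup U v in eq
  ... | true = ⊥-elim (v∉U (lookup⇒[]= v U eq))
  ... | false = refl

  χ-nonneg : ∀ U v → 0ℤ ≤ χ U v
  χ-nonneg U v = ind-nonneg (lookup U v)

  χ-∩ : ∀ U W v → χ (U ∩ W) v ≡ χ U v * χ W v
  χ-∩ U W v = trans (cong ind (lookup-zipWith _∧_ v U W)) (ind-∧ (lookup U v) (lookup W v))

  χ-⁅⁆ : ∀ s v → χ ⁅ s ⁆ v ≡ δ s v
  χ-⁅⁆ s v with s ≟ v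
  ... | yes refl = χ-∈ (x∈⁅x⁆ s)
  ... | no s≢v = χ-∉ (s≢v ∘ sym ∘ x∈⁅y⁆⇒x≡y s)

  χ-∪ : ∀ {X Y} → Empty (X ∩ Y) → ∀ v → χ (X ∪ Y) v ≡ χ X v + χ Y v
  χ-∪ {X} {Y} X∩Y-empty v with v ∈? X | v ∈? Y
  ... | yes v∈X | yes v∈Y = ⊥-elim (Empty∩⇒∉ X∩Y-empty v∈X v∈Y)
  ... | yes v∈X | no v∉Y rewrite χ-∈ (x∈p∪q⁺ {p = X} {Y} (inj₁ v∈X)) | χ-∈ v∈X | χ-∉ v∉Y = refl
  ... | no v∉X | yes v∈Y rewrite χ-∈ (x∈p∪q⁺ {p = X} {Y} (inj₂ v∈Y)) | χ-∉ v∉X | χ-∈ v∈Y = refl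
  ... | no v∉X | no v∉Y rewrite χ-∉ (λ v∈X∪Y → [ v∉X , v∉Y ]′ (x∈p∪q⁻ X Y v∈X∪Y)) | χ-∉ v∉X | χ-∉ v∉Y = refl

  χ-split : ∀ C D v → χ C v ≡ χ (C ─ D) v + χ (C ∩ D) v
  χ-split C D v with v ∈? C | v ∈? D
  ... | yes v∈C | yes v∈D rewrite χ-∈ v∈C | χ-∉ (λ h → proj₂ (∈─⁻ C D h) v∈D) | χ-∈ (x∈p∩q⁺ (v∈C , v∈D)) = refl
  ... | yes v∈C | no v∉D rewrite χ-∈ v∈C | χ-∈ (x∈p∧x∉q⇒x∈p─q v∈C v∉D) | χ-∉ (v∉D ∘ proj₂ ∘ x∈p∩q⁻ C D) = refl
  ... | no v∉C | _ rewrite χ-∉ v∉C | χ-∉ (v∉C ∘ proj₁ ∘ ∈─⁻ C D) | χ-∉ (v∉C ∘ proj₁ ∘ x∈p∩q⁻ C D) = refl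

∑-χ : ∀ {n} (U : Subset n) → sum (χ U) ≡ + ∣ U ∣
∑-χ [] = refl
∑-χ (inside ∷ U) = cong (_+_ 1ℤ) (∑-χ U)
∑-χ (outside ∷ U) = trans (ℤP.+-identityˡ _) (∑-χ U)

∣─∣+∣∩∣ : ∀ {n} (C D : Subset n) → ∣ C ─ D ∣ ℕ.+ ∣ C ∩ D ∣ ≡ ∣ C ∣
∣─∣+∣∩∣ {n} C D = ℤP.+-injective (begin
  + (∣ C ─ D ∣ ℕ.+ ∣ C ∩ D ∣)             ≡⟨ ℤP.pos-+ ∣ C ─ D ∣ ∣ C ∩ D ∣ ⟩
  + ∣ C ─ D ∣ + + ∣ C ∩ D ∣               ≡⟨ cong₂ _+_ (∑-χ (C ─ D)) (∑-χ (C ∩ D)) ⟨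
  sum (χ (C ─ D)) + sum (χ (C ∩ D))       ≡⟨ ∑-distrib-+ (χ (C ─ D)) (χ (C ∩ D)) ⟨
  ∑[ v < n ] (χ (C ─ D) v + χ (C ∩ D) v)  ≡⟨ sum-cong-≗ (sym ∘ χ-split C D) ⟩
  sum (χ C)                               ≡⟨ ∑-χ C ⟩
  + ∣ C ∣                                 ∎)
  where open ≡-Reasoning

∣∪∣≡∣∣+∣∣ : ∀ {n} {X Y : Subset n} → Empty (X ∩ Y) → ∣ X ∪ Y ∣ ≡ ∣ X ∣ ℕ.+ ∣ Y ∣
∣∪∣≡∣∣+∣∣ {n} {X} {Y} X∩Y-empty = ℤP.+-injective (begin
  + ∣ X ∪ Y ∣                           ≡⟨ ∑-χ (X ∪ Y) ⟨
  sum (χ (X ∪ Y))                       ≡⟨ sum-cong-≗ (χ-∪ X∩Y-empty) ⟩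
  ∑[ v < n ] (χ X v + χ Y v)            ≡⟨ ∑-distrib-+ (χ X) (χ Y) ⟩
  sum (χ X) + sum (χ Y)                 ≡⟨ cong₂ _+_ (∑-χ X) (∑-χ Y) ⟩
  + ∣ X ∣ + + ∣ Y ∣                     ≡⟨ ℤP.pos-+ ∣ X ∣ ∣ Y ∣ ⟨
  + (∣ X ∣ ℕ.+ ∣ Y ∣)                   ∎)
  where open ≡-Reasoning

∣∪⁅⁆∣ : ∀ {n} {X : Subset n} {v} → v ∉ X → ∣ X ∪ ⁅ v ⁆ ∣ ≡ suc ∣ X ∣
∣∪⁅⁆∣ {X = X} {v} v∉X = trans (∣∪∣≡∣∣+∣∣ X∩⁅v⁆-empty) (trans (cong (∣ X ∣ ℕ.+_) (∣⁅x⁆∣≡1 v)) (ℕP.+-comm ∣ X ∣ 1))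
  where
  X∩⁅v⁆-empty : Empty (X ∩ ⁅ v ⁆)
  X∩⁅v⁆-empty (u , u∈) with x∈p∩q⁻ X ⁅ v ⁆ u∈
  ... | u∈X , u∈⁅v⁆ = v∉X (subst (_∈ X) (x∈⁅y⁆⇒x≡y v u∈⁅v⁆) u∈X)

∣∣>0⇒Nonempty : ∀ {n} {X : Subset n} → 0 ℕ.< ∣ X ∣ → Nonempty X
∣∣>0⇒Nonempty {X = X} 0<∣X∣ with nonempty? X
... | yes nonempty = nonempty
... | no empty = ⊥-elim (ℕP.<-irrefl (sym (∣Empty∣≡0 empty)) 0<∣X∣)

∣p∣≤1+∣p-x∣ : ∀ {n} (p : Subset n) x → ∣ p ∣ ℕ.≤ suc ∣ p ─ ⁅ x ⁆ ∣
∣p∣≤1+∣p-x∣ p x = begin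
  ∣ p ∣                               ≡⟨ ∣─∣+∣∩∣ p ⁅ x ⁆ ⟨
  ∣ p ─ ⁅ x ⁆ ∣ ℕ.+ ∣ p ∩ ⁅ x ⁆ ∣     ≤⟨ ℕP.+-monoʳ-≤ ∣ p ─ ⁅ x ⁆ ∣ (ℕP.≤-trans (∣p∩q∣≤∣q∣ p ⁅ x ⁆) (ℕP.≤-reflexive (∣⁅x⁆∣≡1 x))) ⟩
  ∣ p ─ ⁅ x ⁆ ∣ ℕ.+ 1                 ≡⟨ ℕP.+-comm ∣ p ─ ⁅ x ⁆ ∣ 1 ⟩
  suc ∣ p ─ ⁅ x ⁆ ∣                   ∎
  where open ℕP.≤-Reasoning

∑-quadratic-≥ : ∀ {n} (X : Subset n) (g : Fin n → ℤ) r c k → (∀ {s} → s ∈ X → c ≤ g s) → (∀ {s} → s ∈ X → g s ≤ k) →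
  (r - k - c) * ∑[ s < n ] (χ X s * g s) + c * k * + ∣ X ∣ ≤ ∑[ s < n ] (χ X s * g s * (r - g s))
∑-quadratic-≥ {n} X g r c k c≤g g≤k = subst (_≤ ∑[ s < n ] (χ X s * g s * (r - g s))) lower (∑-mono-≤ pointwise)
  where
  open ≡-Reasoning
  gap : ∀ x g r c k → x * g * (r - g) - ((r - k - c) * (x * g) + c * k * x) ≡ x * ((g - c) * (k - g))
  gap = solve-∀
  pointwise : ∀ s → (r - k - c) * (χ X s * g s) + c * k * χ X s ≤ χ X s * g s * (r - g s)
  pointwise s = ≤-from-gap _ (nonneg (s ∈? X)) (gap (χ X s) (g s) r c k)
    where
    nonneg : Dec (s ∈ X) → 0ℤ ≤ χ X s * ((g s - c) * (k - g s))
    nonneg (yes s∈X) rewrite χ-∈ s∈X = ℤP.*-monoˡ-≤-nonNeg 1ℤ (*-nonneg (ℤP.i≤j⇒0≤j-i (c≤g s∈X)) (ℤP.i≤j⇒0≤j-i (g≤k s∈X)))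
    nonneg (no s∉X) rewrite χ-∉ s∉X = ℤP.≤-refl
  lower : ∑[ s < n ] ((r - k - c) * (χ X s * g s) + c * k * χ X s) ≡ (r - k - c) * ∑[ s < n ] (χ X s * g s) + c * k * + ∣ X ∣
  lower = begin
    ∑[ s < n ] ((r - k - c) * (χ X s * g s) + c * k * χ X s)
      ≡⟨ ∑-distrib-+ (λ s → (r - k - c) * (χ X s * g s)) (λ s → c * k * χ X s) ⟩
    ∑[ s < n ] ((r - k - c) * (χ X s * g s)) + ∑[ s < n ] (c * k * χ X s)
      ≡⟨ cong₂ _+_ (∑-distribˡ-* (r - k - c) (λ s → χ X s * g s)) (trans (∑-distribˡ-* (c * k) (χ X)) (cong (c * k *_) (∑-χ X))) ⟩
    (r - k - c) * ∑[ s < n ] (χ X s * g s) + c * k * + ∣ X ∣ ∎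

-- Graphs
module _ {n : ℕ} (G : SimpleGraph n) where
  open SimpleGraph G renaming (sym to Adj-sym)

  adj : Fin n → Fin n → ℤ
  adj u v = ind (does (Adj? u v))

  adj-1 : ∀ {u v} → Adj u v → adj u v ≡ 1ℤ
  adj-1 {u} {v} h = cong ind (dec-true (Adj? u v) h)

  adj-0 : ∀ {u v} → ¬ Adj u v → adj u v ≡ 0ℤ
  adj-0 {u} {v} h = cong ind (dec-false (Adj? u v) h)

  adj-irrefl : ∀ u → adj u u ≡ 0ℤ
  adj-irrefl u = adj-0 irrefl

  adj-sym : ∀ u v → adj u v ≡ adj v u
  adj-sym u v with Adj? u v
  ... | yes h = sym (adj-1 (Adj-sym h))
  ... | no h = sym (adj-0 (h ∘ Adj-sym))

  adj-nonneg : ∀ u v → 0ℤ ≤ adj u v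
  adj-nonneg u v = ind-nonneg (does (Adj? u v))

  χ-N : ∀ u v → χ (N G u) v ≡ adj u v
  χ-N u v = cong ind (lookup∘tabulate (λ w → does (Adj? u w)) v)

  ∈N⁺ : ∀ {u v} → Adj u v → v ∈ N G u
  ∈N⁺ {u} {v} h = lookup⇒[]= v (N G u) (trans (lookup∘tabulate (λ w → does (Adj? u w)) v) (dec-true (Adj? u v) h))

  ∈N⁻ : ∀ {u v} → v ∈ N G u → Adj u v
  ∈N⁻ {u} {v} v∈N with Adj? u v | trans (sym (lookup∘tabulate (λ w → does (Adj? u w)) v)) ([]=⇒lookup v∈N)
  ... | yes uv | _ = uv
  ... | no _ | ()

  ∑-adj : ∀ u → sum (adj u) ≡ + ∣ N G u ∣
  ∑-adj u = trans (sum-cong-≗ (sym ∘ χ-N u)) (∑-χ (N G u))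

  ∑-adj*adj : ∀ u v → ∑[ w < n ] (adj u w * adj v w) ≡ + ∣ N G u ∩ N G v ∣
  ∑-adj*adj u v = trans (sum-cong-≗ common) (∑-χ (N G u ∩ N G v))
    where
    common : ∀ w → adj u w * adj v w ≡ χ (N G u ∩ N G v) w
    common w = sym (trans (χ-∩ (N G u) (N G v) w) (cong₂ _*_ (χ-N u w) (χ-N v w)))

  Complete : Subset n → Subset n → Set
  Complete X Y = ∀ {x y} → x ∈ X → y ∈ Y → x ≢ y → Adj x y

  Complete-sym : ∀ {X Y} → Complete X Y → Complete Y X
  Complete-sym XY y∈Y x∈X y≢x = Adj-sym (XY x∈X y∈Y (y≢x ∘ sym))

  CompleteTo : Fin n → Subset n → Set
  CompleteTo s W = ∀ {t} → t ∈ W → Adj s t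

  NoneCompleteTo : Subset n → Subset n → Set
  NoneCompleteTo X Y = ∀ {s} → s ∈ X → ∃[ t ] (t ∈ Y × ¬ Adj s t)

  Complete-∪ : ∀ {X Y} → Complete X X → Complete Y Y → Complete X Y → Complete (X ∪ Y) (X ∪ Y)
  Complete-∪ {X} {Y} XX YY XY {x} {y} x∈X∪Y y∈X∪Y with x∈p∪q⁻ X Y x∈X∪Y | x∈p∪q⁻ X Y y∈X∪Y
  ... | inj₁ x∈X | inj₁ y∈X = XX x∈X y∈X
  ... | inj₁ x∈X | inj₂ y∈Y = XY x∈X y∈Y
  ... | inj₂ x∈Y | inj₁ y∈X = Complete-sym XY x∈Y y∈X
  ... | inj₂ x∈Y | inj₂ y∈Y = YY x∈Y y∈Y

  Complete-⁅⁆ : ∀ {v Y} → CompleteTo v Y → Complete ⁅ v ⁆ Y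
  Complete-⁅⁆ {v} v→Y u∈⁅v⁆ y∈Y _ = subst (λ u → Adj u _) (sym (x∈⁅y⁆⇒x≡y v u∈⁅v⁆)) (v→Y y∈Y)

  ⁅⁆-clique : ∀ v → Complete ⁅ v ⁆ ⁅ v ⁆
  ⁅⁆-clique v x∈⁅v⁆ y∈⁅v⁆ x≢y = ⊥-elim (x≢y (trans (x∈⁅y⁆⇒x≡y v x∈⁅v⁆) (sym (x∈⁅y⁆⇒x≡y v y∈⁅v⁆))))

  Complete-∪ˡ : ∀ {X Y Z} → Complete X Z → Complete Y Z → Complete (X ∪ Y) Z
  Complete-∪ˡ {X} {Y} XZ YZ x∈X∪Y with x∈p∪q⁻ X Y x∈X∪Y
  ... | inj₁ x∈X = XZ x∈X
  ... | inj₂ x∈Y = YZ x∈Y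

  Complete-⊆ : ∀ {X Y X′ Y′} → Complete X Y → X′ ⊆ X → Y′ ⊆ Y → Complete X′ Y′
  Complete-⊆ XY X′⊆X Y′⊆Y x∈X′ y∈Y′ = XY (X′⊆X x∈X′) (Y′⊆Y y∈Y′)

  clique-card-≤ : ∀ {U u v} → Complete U U → u ∈ U → v ∈ U → ∣ U ∣ ℕ.≤ 2 ℕ.+ ∣ N G u ∩ N G v ∣
  clique-card-≤ {U} {u} {v} clique u∈U v∈U = begin
    ∣ U ∣                           ≤⟨ ∣p∣≤1+∣p-x∣ U u ⟩
    suc ∣ U ─ ⁅ u ⁆ ∣               ≤⟨ ℕ.s≤s (∣p∣≤1+∣p-x∣ (U ─ ⁅ u ⁆) v) ⟩
    2 ℕ.+ ∣ U ─ ⁅ u ⁆ ─ ⁅ v ⁆ ∣     ≤⟨ ℕP.+-monoʳ-≤ 2 (p⊆q⇒∣p∣≤∣q∣ common) ⟩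
    2 ℕ.+ ∣ N G u ∩ N G v ∣         ∎
    where
    open ℕP.≤-Reasoning
    common : U ─ ⁅ u ⁆ ─ ⁅ v ⁆ ⊆ N G u ∩ N G v
    common w∈ with ∈─⁻ (U ─ ⁅ u ⁆) ⁅ v ⁆ w∈
    ... | w∈U-u , w∉v with ∈─⁻ U ⁅ u ⁆ w∈U-u
    ...   | w∈U , w∉u = x∈p∩q⁺ ( ∈N⁺ (clique u∈U w∈U (λ { refl → w∉u (x∈⁅x⁆ u) }))
                               , ∈N⁺ (clique v∈U w∈U (λ { refl → w∉v (x∈⁅x⁆ v) })))

  degIn : Subset n → Fin n → ℤ
  degIn W s = ∑[ t < n ] (adj s t * χ W t)

  edges : Subset n → Subset n → ℤ
  edges X Y = bilinear adj (χ X) (χ Y)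

  degIn-card : ∀ W s → degIn W s ≡ + ∣ N G s ∩ W ∣
  degIn-card W s = trans (sum-cong-≗ neighbour-in-W) (∑-χ (N G s ∩ W))
    where
    neighbour-in-W : ∀ t → adj s t * χ W t ≡ χ (N G s ∩ W) t
    neighbour-in-W t = sym (trans (χ-∩ (N G s) W t) (cong (_* χ W t) (χ-N s t)))

  degIn-nonneg : ∀ W s → 0ℤ ≤ degIn W s
  degIn-nonneg W s = ∑-nonneg (λ t → *-nonneg (adj-nonneg s t) (χ-nonneg W t))

  edges-sym : ∀ X Y → edges X Y ≡ edges Y X
  edges-sym X Y = bilinear-sym adj-sym (χ X) (χ Y)

  degIn-complete : ∀ {W s} → (∀ {t} → t ∈ W → s ≢ t → Adj s t) → degIn W s ≡ + ∣ W ∣ - χ W s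
  degIn-complete {W} {s} complete = begin
    ∑[ t < n ] (adj s t * χ W t)           ≡⟨ sum-cong-≗ pointwise ⟩
    ∑[ t < n ] (χ W t - δ s t * χ W t)     ≡⟨ ∑-distrib-- (χ W) (λ t → δ s t * χ W t) ⟩
    sum (χ W) - ∑[ t < n ] (δ s t * χ W t) ≡⟨ cong₂ _-_ (∑-χ W) (∑-δ s (χ W)) ⟩
    + ∣ W ∣ - χ W s                        ∎
    where
    open ≡-Reasoning
    absent : ∀ a d → a * 0ℤ ≡ 0ℤ - d * 0ℤ
    absent = solve-∀
    pointwise : ∀ t → adj s t * χ W t ≡ χ W t - δ s t * χ W t
    pointwise t with t ∈? W
    ... | no t∉W rewrite χ-∉ t∉W = absent (adj s t) (δ s t)
    ... | yes t∈W rewrite χ-∈ t∈W with s ≟ t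
    ...   | yes refl rewrite adj-irrefl s = refl
    ...   | no s≢t rewrite adj-1 (complete t∈W s≢t) = refl

  edges-complete : ∀ {X Y} → Complete X Y → edges X Y ≡ + ∣ Y ∣ * + ∣ X ∣ - + ∣ X ∩ Y ∣
  edges-complete {X} {Y} complete = begin
    ∑[ s < n ] (χ X s * degIn Y s)                     ≡⟨ sum-cong-≗ pointwise ⟩
    ∑[ s < n ] (+ ∣ Y ∣ * χ X s - χ (X ∩ Y) s)         ≡⟨ ∑-distrib-- (λ s → + ∣ Y ∣ * χ X s) (χ (X ∩ Y)) ⟩
    ∑[ s < n ] (+ ∣ Y ∣ * χ X s) - sum (χ (X ∩ Y))     ≡⟨ cong₂ _-_ (trans (∑-distribˡ-* (+ ∣ Y ∣) (χ X)) (cong (+ ∣ Y ∣ *_) (∑-χ X))) (∑-χ (X ∩ Y)) ⟩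
    + ∣ Y ∣ * + ∣ X ∣ - + ∣ X ∩ Y ∣                   ∎
    where
    open ≡-Reasoning
    expand : ∀ x c y → x * (c - y) ≡ c * x - x * y
    expand = solve-∀
    pointwise : ∀ s → χ X s * degIn Y s ≡ + ∣ Y ∣ * χ X s - χ (X ∩ Y) s
    pointwise s with s ∈? X
    ... | no s∉X rewrite χ-∉ s∉X | χ-∉ (s∉X ∘ proj₁ ∘ x∈p∩q⁻ X Y) = sym (cong (_- 0ℤ) (ℤP.*-zeroʳ (+ ∣ Y ∣)))
    ... | yes s∈X = begin
      χ X s * degIn Y s                  ≡⟨ cong (χ X s *_) (degIn-complete (complete s∈X)) ⟩
      χ X s * (+ ∣ Y ∣ - χ Y s)           ≡⟨ expand (χ X s) (+ ∣ Y ∣) (χ Y s) ⟩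
      + ∣ Y ∣ * χ X s - χ X s * χ Y s     ≡⟨ cong (_-_ (+ ∣ Y ∣ * χ X s)) (χ-∩ X Y s) ⟨
      + ∣ Y ∣ * χ X s - χ (X ∩ Y) s       ∎

  edges-⁅⁆ : ∀ s W → edges ⁅ s ⁆ W ≡ degIn W s
  edges-⁅⁆ s W = trans (sum-cong-≗ (λ v → cong (_* degIn W v) (χ-⁅⁆ s v))) (∑-δ s (degIn W))

  ∑-nonadjacent : ∀ X Y (f : Fin n → ℤ) →
    ∑[ s < n ] ∑[ t < n ] (χ X s * χ Y t * (1ℤ - adj s t) * f s) ≡ ∑[ s < n ] (χ X s * f s * (+ ∣ Y ∣ - degIn Y s))
  ∑-nonadjacent X Y f = sum-cong-≗ row
    where
    open ≡-Reasoning
    regroup : ∀ x y a c → x * y * (1ℤ - a) * c ≡ x * c * (y - a * y)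
    regroup = solve-∀
    row : ∀ s → ∑[ t < n ] (χ X s * χ Y t * (1ℤ - adj s t) * f s) ≡ χ X s * f s * (+ ∣ Y ∣ - degIn Y s)
    row s = begin
      ∑[ t < n ] (χ X s * χ Y t * (1ℤ - adj s t) * f s)     ≡⟨ sum-cong-≗ (λ t → regroup (χ X s) (χ Y t) (adj s t) (f s)) ⟩
      ∑[ t < n ] (χ X s * f s * (χ Y t - adj s t * χ Y t))  ≡⟨ ∑-distribˡ-* (χ X s * f s) (λ t → χ Y t - adj s t * χ Y t) ⟩
      χ X s * f s * ∑[ t < n ] (χ Y t - adj s t * χ Y t)    ≡⟨ cong (χ X s * f s *_) (trans (∑-distrib-- (χ Y) (λ t → adj s t * χ Y t)) (cong (_- degIn Y s) (∑-χ Y))) ⟩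
      χ X s * f s * (+ ∣ Y ∣ - degIn Y s)                   ∎

  completeTo? : ∀ s Y → Dec (CompleteTo s Y)
  completeTo? s Y = map′ (λ complete {t} → complete t) (λ complete t → complete) (all? (λ t → t ∈? Y →-dec Adj? s t))

  nonNeighbour : ∀ {s Y} → ¬ CompleteTo s Y → ∃[ t ] (t ∈ Y × ¬ Adj s t)
  nonNeighbour {s} {Y} ¬complete with ¬∀⟶∃¬ n _ (λ t → t ∈? Y →-dec Adj? s t) (λ complete → ¬complete (λ {t} → complete t))
  ... | t , ¬[t∈Y→Adj] with t ∈? Y
  ...   | yes t∈Y = t , t∈Y , λ st → ¬[t∈Y→Adj] (λ _ → st)
  ...   | no t∉Y = ⊥-elim (¬[t∈Y→Adj] (⊥-elim ∘ t∉Y))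

  someCompleteTo⊎noneCompleteTo : ∀ X Y → (∃[ s ] (s ∈ X × CompleteTo s Y)) ⊎ NoneCompleteTo X Y
  someCompleteTo⊎noneCompleteTo X Y with any? (λ s → s ∈? X ×-dec completeTo? s Y)
  ... | yes (s , s∈X , complete) = inj₁ (s , s∈X , complete)
  ... | no none = inj₂ (λ {s} s∈X → nonNeighbour (λ complete → none (s , s∈X , complete)))

  HasDominatingVertex : Subset n → Set
  HasDominatingVertex S = ∃[ z ] (z ∈ S × (∀ {w} → w ∈ S → w ≢ z → Adj z w))

  dominating-vertex : ∀ {X Y s} → Complete X X → s ∈ X → CompleteTo s Y → HasDominatingVertex (X ∪ Y)
  dominating-vertex {X} {Y} {s} clique s∈X s→Y = s , x∈p∪q⁺ (inj₁ s∈X) , adjacent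
    where
    adjacent : ∀ {w} → w ∈ X ∪ Y → w ≢ s → Adj s w
    adjacent {w} w∈X∪Y w≢s = [ (λ w∈X → clique s∈X w∈X (w≢s ∘ sym)) , s→Y ]′ (x∈p∪q⁻ X Y w∈X∪Y)

  unextendable⇒maximal : ∀ {C} → Complete C C → (∀ {v} → v ∉ C → ¬ CompleteTo v C) → IsMaximalClique G C
  unextendable⇒maximal {C} clique unextendable = clique , λ D D-clique C⊆D → ⊆-antisym (D⊆C D-clique C⊆D) C⊆D
    where
    D⊆C : ∀ {D} → Complete D D → C ⊆ D → D ⊆ C
    D⊆C {D} D-clique C⊆D {v} v∈D with v ∈? C
    ... | yes v∈C = v∈C
    ... | no v∉C = ⊥-elim (unextendable v∉C (λ t∈C → D-clique v∈D (C⊆D t∈C) (λ { refl → v∉C t∈C })))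

  record OverlappingCliques (A B I : Subset n) : Set where
    field
      A-clique : Complete A A
      B-clique : Complete B B
      I-clique : Complete I I
      A-I : Complete A I
      B-I : Complete B I
      A∩B-empty : Empty (A ∩ B)
      A∩I-empty : Empty (A ∩ I)
      B∩I-empty : Empty (B ∩ I)

  overlapping-cliques : ∀ {C₁ C₂} → Complete C₁ C₁ → Complete C₂ C₂ → OverlappingCliques (C₁ ─ C₂) (C₂ ─ C₁) (C₁ ∩ C₂)
  overlapping-cliques {C₁} {C₂} C₁-clique C₂-clique = record
    { A-clique = Complete-⊆ C₁-clique A⊆C₁ A⊆C₁
    ; B-clique = Complete-⊆ C₂-clique B⊆C₂ B⊆C₂
    ; I-clique = Complete-⊆ C₁-clique I⊆C₁ I⊆C₁
    ; A-I = Complete-⊆ C₁-clique A⊆C₁ I⊆C₁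
    ; B-I = Complete-⊆ C₂-clique B⊆C₂ I⊆C₂
    ; A∩B-empty = λ (v , v∈A∩B) → let v∈A , v∈B = x∈p∩q⁻ (C₁ ─ C₂) (C₂ ─ C₁) v∈A∩B in proj₂ (∈─⁻ C₂ C₁ v∈B) (A⊆C₁ v∈A)
    ; A∩I-empty = λ (v , v∈A∩I) → let v∈A , v∈I = x∈p∩q⁻ (C₁ ─ C₂) (C₁ ∩ C₂) v∈A∩I in proj₂ (∈─⁻ C₁ C₂ v∈A) (I⊆C₂ v∈I)
    ; B∩I-empty = λ (v , v∈B∩I) → let v∈B , v∈I = x∈p∩q⁻ (C₂ ─ C₁) (C₁ ∩ C₂) v∈B∩I in proj₂ (∈─⁻ C₂ C₁ v∈B) (I⊆C₁ v∈I)
    }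
    where
    A⊆C₁ : C₁ ─ C₂ ⊆ C₁
    A⊆C₁ = proj₁ ∘ ∈─⁻ C₁ C₂
    B⊆C₂ : C₂ ─ C₁ ⊆ C₂
    B⊆C₂ = proj₁ ∘ ∈─⁻ C₂ C₁
    I⊆C₁ : C₁ ∩ C₂ ⊆ C₁
    I⊆C₁ = proj₁ ∘ x∈p∩q⁻ C₁ C₂
    I⊆C₂ : C₁ ∩ C₂ ⊆ C₂
    I⊆C₂ = proj₂ ∘ x∈p∩q⁻ C₁ C₂

  swap-overlap : ∀ {A B I} → OverlappingCliques A B I → OverlappingCliques B A I
  swap-overlap ov = record
    { A-clique = B-clique ; B-clique = A-clique ; I-clique = I-clique ; A-I = B-I ; B-I = A-I
    ; A∩B-empty = Empty∩-sym A∩B-empty ; A∩I-empty = B∩I-empty ; B∩I-empty = A∩I-empty }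
    where open OverlappingCliques ov

  shrink-overlap : ∀ {A A′ B I} → A′ ⊆ A → OverlappingCliques A B I → OverlappingCliques A′ B I
  shrink-overlap A′⊆A ov = record
    { A-clique = Complete-⊆ A-clique A′⊆A A′⊆A ; B-clique = B-clique ; I-clique = I-clique
    ; A-I = Complete-⊆ A-I A′⊆A (λ v∈I → v∈I) ; B-I = B-I
    ; A∩B-empty = λ (v , v∈A′∩B) → Empty∩⇒∉ A∩B-empty (A′⊆A (proj₁ (x∈p∩q⁻ _ _ v∈A′∩B))) (proj₂ (x∈p∩q⁻ _ _ v∈A′∩B))
    ; A∩I-empty = λ (v , v∈A′∩I) → Empty∩⇒∉ A∩I-empty (A′⊆A (proj₁ (x∈p∩q⁻ _ _ v∈A′∩I))) (proj₂ (x∈p∩q⁻ _ _ v∈A′∩I))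
    ; B∩I-empty = B∩I-empty }
    where open OverlappingCliques ov

  grow-shared : ∀ {A B I v} → OverlappingCliques A B I → v ∉ A → v ∉ B → v ∉ I →
    CompleteTo v A → CompleteTo v B → CompleteTo v I → OverlappingCliques A B (I ∪ ⁅ v ⁆)
  grow-shared {v = v} ov v∉A v∉B v∉I v→A v→B v→I = record
    { A-clique = A-clique ; B-clique = B-clique
    ; I-clique = Complete-∪ I-clique (⁅⁆-clique v) (Complete-sym (Complete-⁅⁆ v→I))
    ; A-I = Complete-sym (Complete-∪ˡ (Complete-sym A-I) (Complete-⁅⁆ v→A))
    ; B-I = Complete-sym (Complete-∪ˡ (Complete-sym B-I) (Complete-⁅⁆ v→B))
    ; A∩B-empty = A∩B-empty
    ; A∩I-empty = Empty∩-sym (Empty∪⁅⁆∩ (Empty∩-sym A∩I-empty) v∉A)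
    ; B∩I-empty = Empty∩-sym (Empty∪⁅⁆∩ (Empty∩-sym B∩I-empty) v∉B) }
    where open OverlappingCliques ov

  grow-private : ∀ {A B I v} → OverlappingCliques A B I → v ∉ B → v ∉ I →
    CompleteTo v A → CompleteTo v I → OverlappingCliques (A ∪ ⁅ v ⁆) B I
  grow-private {v = v} ov v∉B v∉I v→A v→I = record
    { A-clique = Complete-∪ A-clique (⁅⁆-clique v) (Complete-sym (Complete-⁅⁆ v→A))
    ; B-clique = B-clique ; I-clique = I-clique
    ; A-I = Complete-∪ˡ A-I (Complete-⁅⁆ v→I)
    ; B-I = B-I
    ; A∩B-empty = Empty∪⁅⁆∩ A∩B-empty v∉B
    ; A∩I-empty = Empty∪⁅⁆∩ A∩I-empty v∉I
    ; B∩I-empty = B∩I-empty }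
    where open OverlappingCliques ov

-- The arithmetic certificate
-- partitionForm m p q e x y z is wᵀ(A + 3I)w for w = x·1_A + y·1_B + z·1_I, where p = |A|,
-- q = |B|, m = |I| and e is the number of edges between A and B; partitionSum is ∑ w.
partitionSum : ℤ → ℤ → ℤ → ℤ → ℤ → ℤ → ℤ
partitionSum m p q x y z = x * p + y * q + z * m

partitionForm : ℤ → ℤ → ℤ → ℤ → ℤ → ℤ → ℤ → ℤ
partitionForm m p q e x y z =
  x * x * (p * (p + + 2)) + y * y * (q * (q + + 2)) + z * z * (m * (m + + 2))
  + + 2 * x * z * p * m + + 2 * y * z * q * m + + 2 * x * y * e

PartitionInequality : ℤ → ℤ → ℤ → ℤ → Set
PartitionInequality m p q e = ∀ x y z → partitionSum m p q x y z * partitionSum m p q x y z ≤ + 7 * partitionForm m p q e x y z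

PartitionInequality-resp : ∀ {m p q e m′ p′ q′ e′} → m ≡ m′ → p ≡ p′ → q ≡ q′ → e ≡ e′ →
  PartitionInequality m p q e → PartitionInequality m′ p′ q′ e′
PartitionInequality-resp refl refl refl refl inequality = inequality

Violates : ℤ → ℤ → ℤ → ℤ → ℤ → ℤ → ℤ → Set
Violates m p q e x y z = + 7 * partitionForm m p q e x y z < partitionSum m p q x y z * partitionSum m p q x y z

-- Violates with z = −t, after adding 14tm(xp + yq) to both sides: only natural numbers
-- occur, which keeps the evaluation of the certificate cheap.
positivePart : ℕ → ℕ → ℕ → ℕ → ℕ → ℕ → ℕ → ℕ
positivePart m p q e x y t = x ℕ.* x ℕ.* (p ℕ.* (p ℕ.+ 2)) ℕ.+ y ℕ.* y ℕ.* (q ℕ.* (q ℕ.+ 2)) ℕ.+ t ℕ.* t ℕ.* (m ℕ.* (m ℕ.+ 2)) ℕ.+ 2 ℕ.* x ℕ.* y ℕ.* e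

mixedPart : ℕ → ℕ → ℕ → ℕ → ℕ → ℕ → ℕ
mixedPart m p q x y t = (x ℕ.* p ℕ.+ y ℕ.* q) ℕ.* (x ℕ.* p ℕ.+ y ℕ.* q) ℕ.+ t ℕ.* t ℕ.* (m ℕ.* m) ℕ.+ 12 ℕ.* t ℕ.* m ℕ.* (x ℕ.* p ℕ.+ y ℕ.* q)

Violatesℕ : ℕ → ℕ → ℕ → ℕ → ℕ → ℕ → ℕ → Set
Violatesℕ m p q e x y t = 7 ℕ.* positivePart m p q e x y t ℕ.< mixedPart m p q x y t

violatesℕ? : ∀ m p q e x y t → Dec (Violatesℕ m p q e x y t)
violatesℕ? m p q e x y t = 7 ℕ.* positivePart m p q e x y t ℕP.<? mixedPart m p q x y t

cast-linear : ∀ p q x y → + (x ℕ.* p ℕ.+ y ℕ.* q) ≡ + x * + p + + y * + q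
cast-linear p q x y = trans (ℤP.pos-+ (x ℕ.* p) (y ℕ.* q)) (cong₂ _+_ (ℤP.pos-* x p) (ℤP.pos-* y q))

cast-square : ∀ a b → + (a ℕ.* a ℕ.* (b ℕ.* (b ℕ.+ 2))) ≡ + a * + a * (+ b * (+ b + + 2))
cast-square a b = trans (ℤP.pos-* (a ℕ.* a) (b ℕ.* (b ℕ.+ 2)))
  (cong₂ _*_ (ℤP.pos-* a a) (trans (ℤP.pos-* b (b ℕ.+ 2)) (cong (+ b *_) (ℤP.pos-+ b 2))))

cast-product₄ : ∀ a b c d → + (a ℕ.* b ℕ.* c ℕ.* d) ≡ + a * + b * + c * + d
cast-product₄ a b c d = trans (ℤP.pos-* (a ℕ.* b ℕ.* c) d) (cong (_* + d) (trans (ℤP.pos-* (a ℕ.* b) c) (cong (_* + c) (ℤP.pos-* a b))))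

cast-positivePart : ∀ m p q e x y t → + positivePart m p q e x y t ≡
  + x * + x * (+ p * (+ p + + 2)) + + y * + y * (+ q * (+ q + + 2)) + + t * + t * (+ m * (+ m + + 2)) + + 2 * + x * + y * + e
cast-positivePart m p q e x y t =
  trans (ℤP.pos-+ (x ℕ.* x ℕ.* (p ℕ.* (p ℕ.+ 2)) ℕ.+ y ℕ.* y ℕ.* (q ℕ.* (q ℕ.+ 2)) ℕ.+ t ℕ.* t ℕ.* (m ℕ.* (m ℕ.+ 2))) (2 ℕ.* x ℕ.* y ℕ.* e))
    (cong₂ _+_ (trans (ℤP.pos-+ (x ℕ.* x ℕ.* (p ℕ.* (p ℕ.+ 2)) ℕ.+ y ℕ.* y ℕ.* (q ℕ.* (q ℕ.+ 2))) (t ℕ.* t ℕ.* (m ℕ.* (m ℕ.+ 2))))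
                      (cong₂ _+_ (trans (ℤP.pos-+ (x ℕ.* x ℕ.* (p ℕ.* (p ℕ.+ 2))) (y ℕ.* y ℕ.* (q ℕ.* (q ℕ.+ 2))))
                                        (cong₂ _+_ (cast-square x p) (cast-square y q)))
                                 (cast-square t m)))
               (cast-product₄ 2 x y e))

cast-mixedPart : ∀ m p q x y t → + mixedPart m p q x y t ≡
  (+ x * + p + + y * + q) * (+ x * + p + + y * + q) + + t * + t * (+ m * + m) + + 12 * + t * + m * (+ x * + p + + y * + q)
cast-mixedPart m p q x y t =
  trans (ℤP.pos-+ (U ℕ.* U ℕ.+ t ℕ.* t ℕ.* (m ℕ.* m)) (12 ℕ.* t ℕ.* m ℕ.* U))
    (cong₂ _+_ (trans (ℤP.pos-+ (U ℕ.* U) (t ℕ.* t ℕ.* (m ℕ.* m)))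
                      (cong₂ _+_ (trans (ℤP.pos-* U U) (cong₂ _*_ (cast-linear p q x y) (cast-linear p q x y)))
                                 (trans (ℤP.pos-* (t ℕ.* t) (m ℕ.* m)) (cong₂ _*_ (ℤP.pos-* t t) (ℤP.pos-* m m)))))
               (trans (ℤP.pos-* (12 ℕ.* t ℕ.* m) U)
                      (cong₂ _*_ (trans (ℤP.pos-* (12 ℕ.* t) m) (cong (_* + m) (ℤP.pos-* 12 t))) (cast-linear p q x y))))
  where
  U : ℕ
  U = x ℕ.* p ℕ.+ y ℕ.* q

Violatesℕ⇒Violates : ∀ {m p q e x y t} → Violatesℕ m p q e x y t → Violates (+ m) (+ p) (+ q) (+ e) (+ x) (+ y) (- + t)
Violatesℕ⇒Violates {m} {p} {q} {e} {x} {y} {t} violated =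
  subst₂ _<_ (trans (cong (_- shift) (trans (ℤP.pos-* 7 (positivePart m p q e x y t)) (cong (+ 7 *_) (cast-positivePart m p q e x y t))))
                    (form-identity (+ m) (+ p) (+ q) (+ e) (+ x) (+ y) (+ t)))
             (trans (cong (_- shift) (cast-mixedPart m p q x y t)) (sum-identity (+ m) (+ p) (+ q) (+ x) (+ y) (+ t)))
             (ℤP.+-monoˡ-< (- shift) (ℤ.+<+ violated))
  where
  shift : ℤ
  shift = + 14 * + t * + m * (+ x * + p + + y * + q)
  form-identity : ∀ m p q e x y t →
    + 7 * (x * x * (p * (p + + 2)) + y * y * (q * (q + + 2)) + t * t * (m * (m + + 2)) + + 2 * x * y * e) - + 14 * t * m * (x * p + y * q)
      ≡ + 7 * (x * x * (p * (p + + 2)) + y * y * (q * (q + + 2)) + (- t) * (- t) * (m * (m + + 2))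
               + + 2 * x * (- t) * p * m + + 2 * y * (- t) * q * m + + 2 * x * y * e)
  form-identity = solve-∀
  sum-identity : ∀ m p q x y t →
    (x * p + y * q) * (x * p + y * q) + t * t * (m * m) + + 12 * t * m * (x * p + y * q) - + 14 * t * m * (x * p + y * q)
      ≡ (x * p + y * q + (- t) * m) * (x * p + y * q + (- t) * m)
  sum-identity = solve-∀

not-violated : ∀ {m p q E e x y z} → PartitionInequality m p q E → 0ℤ ≤ x → 0ℤ ≤ y → E ≤ e → ¬ Violates m p q e x y z
not-violated {m} {p} {q} {E} {e} {x} {y} {z} inequality 0≤x 0≤y E≤e violation =
  ℤP.<-irrefl refl (ℤP.<-≤-trans violation (ℤP.≤-trans (inequality x y z) (ℤP.*-monoˡ-≤-nonNeg (+ 7) form-mono)))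
  where
  gap : ∀ F x y E e → F + + 2 * x * y * e - (F + + 2 * x * y * E) ≡ + 2 * x * y * (e - E)
  gap = solve-∀
  form-mono : partitionForm m p q E x y z ≤ partitionForm m p q e x y z
  form-mono = ≤-from-gap _ (*-nonneg (*-nonneg (*-nonneg {+ 2} (ℤ.+≤+ ℕ.z≤n) 0≤x) 0≤y) (ℤP.i≤j⇒0≤j-i E≤e))
                         (gap (x * x * (p * (p + + 2)) + y * y * (q * (q + + 2)) + z * z * (m * (m + + 2))
                                + + 2 * x * z * p * m + + 2 * y * z * q * m) x y E e)

floor-bound : ∀ {E e d N} → 0ℤ ≤ d → E * d ≤ N → N < (1ℤ + e) * d → E ≤ e
floor-bound {E} {e} {d} 0≤d Ed≤N N<[1+e]d = ℤP.≮⇒≥ λ e<E →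
  ℤP.<-irrefl refl (ℤP.<-≤-trans N<[1+e]d (ℤP.≤-trans (ℤP.*-monoʳ-≤-nonNeg d ⦃ ℤ.nonNegative 0≤d ⦄ (ℤP.i<j⇒suc[i]≤j e<E)) Ed≤N))

deficit : ℕ → ℤ
deficit m = + 27 - + m

-- ⌊(27 − m)pq / (p + q − 27 + m)⌋; the divisor is written suc (_ ∸ 1) only to make it
-- visibly nonzero, and the floor property is checked in Refuted anyway.
edgeBound : ℕ → ℕ → ℕ → ℕ
edgeBound m p q = ((27 ∸ m) ℕ.* p ℕ.* q) / suc (p ℕ.+ q ∸ (27 ∸ m) ∸ 1)

-- The weights (5q, 5p, −t), with t the integer nearest to 30pq/(3m + 7), almost minimise
-- the form in z; they refute every admissible triple except the two exceptional ones.
zWitness : ℕ → ℕ → ℕ → ℕ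
zWitness m p q = (60 ℕ.* p ℕ.* q ℕ.+ 3 ℕ.* m ℕ.+ 7) / suc (6 ℕ.* m ℕ.+ 13)

Admissible : ℕ → ℕ → ℕ → Set
Admissible m p q = 29 ℕ.≤ m ℕ.+ p × 29 ℕ.≤ m ℕ.+ q × m ℕ.+ p ℕ.≤ 107 × m ℕ.+ q ℕ.≤ 107

Exceptional : ℕ → ℕ → ℕ → Set
Exceptional m p q = (m ≡ 27 × p ≡ 2 × q ≡ 2) ⊎ (m ≡ 22 × p ≡ 7 × q ≡ 7)

Refuted : ℕ → ℕ → ℕ → Set
Refuted m p q =
  0ℤ ≤ d × deficit m * (+ p * + q) < (1ℤ + + edgeBound m p q) * d
  × Violatesℕ m p q (edgeBound m p q) (5 ℕ.* q) (5 ℕ.* p) (zWitness m p q)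
  where
  d : ℤ
  d = + p + + q - deficit m

Certified : ℕ → ℕ → ℕ → Set
Certified m p q = Admissible m p q → Exceptional m p q ⊎ Refuted m p q

certified? : ∀ m p q → Dec (Certified m p q)
certified? m p q =
  (29 ℕP.≤? m ℕ.+ p ×-dec 29 ℕP.≤? m ℕ.+ q ×-dec m ℕ.+ p ℕP.≤? 107 ×-dec m ℕ.+ q ℕP.≤? 107)
  →-dec (((m ℕP.≟ 27 ×-dec p ℕP.≟ 2 ×-dec q ℕP.≟ 2) ⊎-dec (m ℕP.≟ 22 ×-dec p ℕP.≟ 7 ×-dec q ℕP.≟ 7))
         ⊎-dec (0ℤ ℤP.≤? d ×-dec deficit m * (+ p * + q) ℤP.<? (1ℤ + + edgeBound m p q) * d
                ×-dec violatesℕ? m p q (edgeBound m p q) (5 ℕ.* q) (5 ℕ.* p) (zWitness m p q)))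
  where
  d : ℤ
  d = + p + + q - deficit m

all< : ℕ → (ℕ → Bool) → Bool
all< zero f = true
all< (suc k) f = f k ∧ all< k f

all<-sound : ∀ {k} (f : ℕ → Bool) → T (all< k f) → ∀ {i} → i ℕ.< k → T (f i)
all<-sound {suc k} f holds i<1+k with Equivalence.to (T-∧ {f k} {all< k f}) holds | ℕP.m<1+n⇒m<n∨m≡n i<1+k
... | _ , rest | inj₁ i<k = all<-sound f rest i<k
... | fk , _ | inj₂ refl = fk

certificate : T (all< 6 λ i → all< 86 λ p → all< 86 λ q → isYes (certified? (22 ℕ.+ i) p q))
certificate = _

certified : ∀ {m p q} → 22 ℕ.≤ m → m ℕ.≤ 27 → p ℕ.< 86 → q ℕ.< 86 → Certified m p q
certified {m} {p} {q} 22≤m m≤27 p<86 q<86 =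
  subst (λ a → Certified a p q) (ℕP.m+[n∸m]≡n 22≤m)
    (toWitness {a? = certified? (22 ℕ.+ (m ∸ 22)) p q}
      (all<-sound {86} (λ q → isYes (certified? (22 ℕ.+ (m ∸ 22)) p q))
        (all<-sound {86} (λ p → all< 86 λ q → isYes (certified? (22 ℕ.+ (m ∸ 22)) p q))
          (all<-sound {6} (λ i → all< 86 λ p → all< 86 λ q → isYes (certified? (22 ℕ.+ i) p q)) certificate i<6)
          p<86)
        q<86))
  where
  i<6 : m ∸ 22 ℕ.< 6
  i<6 = ℕP.+-cancelˡ-< 22 (m ∸ 22) 6 (subst (ℕ._< 28) (sym (ℕP.m+[n∸m]≡n 22≤m)) (ℕ.s≤s m≤27))

exceptional-sizes : ∀ {m p q} {E : ℤ} → 22 ℕ.≤ m → m ℕ.≤ 27 → Admissible m p q →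
  (+ p + + q - deficit m) * E ≤ deficit m * (+ p * + q) →
  PartitionInequality (+ m) (+ p) (+ q) E → Exceptional m p q
exceptional-sizes {m} {p} {q} {E} 22≤m m≤27 admissible@(_ , _ , m+p≤107 , m+q≤107) edge-bound inequality =
  [ (λ exceptional → exceptional) , (λ refuted → ⊥-elim (not-refuted refuted)) ]′
    (certified 22≤m m≤27 (below-86 m+p≤107) (below-86 m+q≤107) admissible)
  where
  below-86 : ∀ {r} → m ℕ.+ r ℕ.≤ 107 → r ℕ.< 86
  below-86 {r} m+r≤107 = ℕP.+-cancelˡ-≤ 22 (suc r) 86 (ℕP.≤-trans (ℕP.+-monoˡ-≤ (suc r) 22≤m) (subst (ℕ._≤ 108) (sym (ℕP.+-suc m r)) (ℕ.s≤s m+r≤107)))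
  not-refuted : ¬ Refuted m p q
  not-refuted (0≤d , floor , violated) =
    not-violated {+ m} {+ p} {+ q} {E} {+ edgeBound m p q} {+ (5 ℕ.* q)} {+ (5 ℕ.* p)} { - + zWitness m p q }
      inequality (ℤ.+≤+ ℕ.z≤n) (ℤ.+≤+ ℕ.z≤n)
      (floor-bound {E} {+ edgeBound m p q} {+ p + + q - deficit m} {deficit m * (+ p * + q)}
                   0≤d (subst (_≤ deficit m * (+ p * + q)) (ℤP.*-comm (+ p + + q - deficit m) E) edge-bound) floor)
      (Violatesℕ⇒Violates {m} {p} {q} {edgeBound m p q} {5 ℕ.* q} {5 ℕ.* p} {zWitness m p q} violated)

-- The strongly regular graph with parameters (1911, 270, 105, 27)
-- The order is kept abstract (n ≡ 1911) so that no sum over Fin 1911 is ever unfolded.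
module SRG {n : ℕ} (n≡1911 : n ≡ 1911) (G : SimpleGraph n) (srg : IsSRG G 270 105 27) where
  open SimpleGraph G using (Adj?)
  open IsSRG srg

  codegree : ∀ u v → ∑[ w < n ] (adj G u w * adj G v w) ≡ + 27 + + 78 * adj G u v + + 243 * δ u v
  codegree u v with u ≟ v
  ... | yes refl rewrite adj-irrefl G u = begin
    ∑[ w < n ] (adj G u w * adj G u w)  ≡⟨ sum-cong-≗ (λ w → ind-idem (does (Adj? u w))) ⟩
    sum (adj G u)                       ≡⟨ ∑-adj G u ⟩
    + ∣ N G u ∣                         ≡⟨ cong +_ (regular u) ⟩
    + 270                               ∎
    where open ≡-Reasoning
  ... | no u≢v with Adj? u v
  ...   | yes uv = trans (∑-adj*adj G u v) (cong +_ (adjCommon u v u≢v uv))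
  ...   | no ¬uv = trans (∑-adj*adj G u v) (cong +_ (nonadjCommon u v u≢v ¬uv))

  clique-card-≤-107 : ∀ {U u v} → Complete G U U → u ∈ U → v ∈ U → u ≢ v → ∣ U ∣ ℕ.≤ 107
  clique-card-≤-107 {U} clique u∈U v∈U u≢v =
    subst (λ c → ∣ U ∣ ℕ.≤ 2 ℕ.+ c) (adjCommon _ _ u≢v (clique u∈U v∈U u≢v)) (clique-card-≤ G clique u∈U v∈U)

  -- A + 3I: the eigenvalues of A are 270, 81 and −3, so M is positive semidefinite.
  M : Fin n → Fin n → ℤ
  M u v = adj G u v + + 3 * δ u v

  M-sym : ∀ u v → M u v ≡ M v u
  M-sym u v = cong₂ (λ a d → a + + 3 * d) (adj-sym G u v) (δ-sym u v)

  ∑-M : ∀ u → ∑[ v < n ] M u v ≡ + 273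
  ∑-M u = begin
    ∑[ v < n ] (adj G u v + + 3 * δ u v)           ≡⟨ ∑-distrib-+ (adj G u) (λ v → + 3 * δ u v) ⟩
    sum (adj G u) + ∑[ v < n ] (+ 3 * δ u v)       ≡⟨ cong₂ _+_ (trans (∑-adj G u) (cong +_ (regular u))) (∑-distribˡ-* (+ 3) (δ u)) ⟩
    + 270 + + 3 * sum (δ u)                        ≡⟨ cong (λ s → + 270 + + 3 * s) ∑-δu ⟩
    + 273                                          ∎
    where
    open ≡-Reasoning
    ∑-δu : sum (δ u) ≡ 1ℤ
    ∑-δu = trans (sum-cong-≗ (λ v → sym (ℤP.*-identityʳ (δ u v)))) (∑-δ u (λ _ → 1ℤ))

  M-squared : ∀ s t → ∑[ v < n ] (M s v * M t v) ≡ + 84 * M s t + + 27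
  M-squared s t = begin
    ∑[ v < n ] (M s v * M t v)
      ≡⟨ sum-cong-≗ (λ v → expand (adj G s v) (δ s v) (adj G t v) (δ t v)) ⟩
    ∑[ v < n ] (adj G s v * adj G t v + + 3 * (δ s v * adj G t v) + + 3 * (δ t v * M s v))
      ≡⟨ ∑-distrib-+₃ (λ v → adj G s v * adj G t v) (λ v → + 3 * (δ s v * adj G t v)) (λ v → + 3 * (δ t v * M s v)) ⟩
    ∑[ v < n ] (adj G s v * adj G t v) + ∑[ v < n ] (+ 3 * (δ s v * adj G t v)) + ∑[ v < n ] (+ 3 * (δ t v * M s v))
      ≡⟨ cong₂ _+_ (cong₂ _+_ (codegree s t) (trans (∑-distribˡ-* (+ 3) (λ v → δ s v * adj G t v)) (cong (+ 3 *_) (∑-δ s (adj G t)))))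
                   (trans (∑-distribˡ-* (+ 3) (λ v → δ t v * M s v)) (cong (+ 3 *_) (∑-δ t (M s)))) ⟩
    + 27 + + 78 * adj G s t + + 243 * δ s t + + 3 * adj G t s + + 3 * M s t
      ≡⟨ cong (λ a → + 27 + + 78 * adj G s t + + 243 * δ s t + + 3 * a + + 3 * M s t) (adj-sym G t s) ⟩
    + 27 + + 78 * adj G s t + + 243 * δ s t + + 3 * adj G s t + + 3 * M s t
      ≡⟨ collect (adj G s t) (δ s t) ⟩
    + 84 * M s t + + 27 ∎
    where
    open ≡-Reasoning
    expand : ∀ a d b e → (a + + 3 * d) * (b + + 3 * e) ≡ a * b + + 3 * (d * b) + + 3 * (e * (a + + 3 * d))
    expand = solve-∀
    collect : ∀ a d → + 27 + + 78 * a + + 243 * d + + 3 * a + + 3 * (a + + 3 * d) ≡ + 84 * (a + + 3 * d) + + 27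
    collect = solve-∀

  image : (Fin n → ℤ) → Fin n → ℤ
  image w v = ∑[ s < n ] (M v s * w s)

  ∑-image : ∀ w → sum (image w) ≡ + 273 * sum w
  ∑-image w = begin
    ∑[ v < n ] ∑[ s < n ] (M v s * w s)   ≡⟨ ∑-comm (λ v s → M v s * w s) ⟩
    ∑[ s < n ] ∑[ v < n ] (M v s * w s)   ≡⟨ sum-cong-≗ column ⟩
    ∑[ s < n ] (+ 273 * w s)              ≡⟨ ∑-distribˡ-* (+ 273) w ⟩
    + 273 * sum w                         ∎
    where
    open ≡-Reasoning
    column : ∀ s → ∑[ v < n ] (M v s * w s) ≡ + 273 * w s
    column s = begin
      ∑[ v < n ] (M v s * w s)  ≡⟨ sum-cong-≗ (λ v → trans (cong (_* w s) (M-sym v s)) (ℤP.*-comm (M s v) (w s))) ⟩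
      ∑[ v < n ] (w s * M s v)  ≡⟨ ∑-distribˡ-* (w s) (M s) ⟩
      w s * sum (M s)           ≡⟨ trans (cong (w s *_) (∑-M s)) (ℤP.*-comm (w s) (+ 273)) ⟩
      + 273 * w s               ∎

  ∑-image² : ∀ w → ∑[ v < n ] (image w v * image w v) ≡ + 84 * bilinear M w w + + 27 * (sum w * sum w)
  ∑-image² w = begin
    ∑[ v < n ] (image w v * image w v)
      ≡⟨ sum-cong-≗ (λ v → ∑*∑ (λ s → M v s * w s) (λ t → M v t * w t)) ⟩
    ∑[ v < n ] ∑[ s < n ] ∑[ t < n ] (M v s * w s * (M v t * w t))
      ≡⟨ ∑-comm (λ v s → ∑[ t < n ] (M v s * w s * (M v t * w t))) ⟩
    ∑[ s < n ] ∑[ v < n ] ∑[ t < n ] (M v s * w s * (M v t * w t))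
      ≡⟨ sum-cong-≗ (λ s → trans (∑-comm (λ v t → M v s * w s * (M v t * w t))) (sum-cong-≗ (pair s))) ⟩
    ∑[ s < n ] ∑[ t < n ] (w s * w t * (+ 84 * M s t + + 27))
      ≡⟨ sum-cong-≗ row ⟩
    ∑[ s < n ] (+ 84 * (w s * image w s) + + 27 * (w s * sum w))
      ≡⟨ ∑-distrib-+ (λ s → + 84 * (w s * image w s)) (λ s → + 27 * (w s * sum w)) ⟩
    ∑[ s < n ] (+ 84 * (w s * image w s)) + ∑[ s < n ] (+ 27 * (w s * sum w))
      ≡⟨ cong₂ _+_ (∑-distribˡ-* (+ 84) (λ s → w s * image w s))
                   (trans (∑-distribˡ-* (+ 27) (λ s → w s * sum w)) (cong (+ 27 *_) (sum-times (sum w)))) ⟩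
    + 84 * bilinear M w w + + 27 * (sum w * sum w) ∎
    where
    open ≡-Reasoning
    regroup : ∀ a b x y → a * x * (b * y) ≡ x * y * (a * b)
    regroup = solve-∀
    pair : ∀ s t → ∑[ v < n ] (M v s * w s * (M v t * w t)) ≡ w s * w t * (+ 84 * M s t + + 27)
    pair s t = begin
      ∑[ v < n ] (M v s * w s * (M v t * w t))  ≡⟨ sum-cong-≗ (λ v → regroup (M v s) (M v t) (w s) (w t)) ⟩
      ∑[ v < n ] (w s * w t * (M v s * M v t))  ≡⟨ ∑-distribˡ-* (w s * w t) (λ v → M v s * M v t) ⟩
      w s * w t * ∑[ v < n ] (M v s * M v t)    ≡⟨ cong (w s * w t *_) (trans (sum-cong-≗ (λ v → cong₂ _*_ (M-sym v s) (M-sym v t))) (M-squared s t)) ⟩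
      w s * w t * (+ 84 * M s t + + 27)         ∎
    spread : ∀ x y m → x * y * (+ 84 * m + + 27) ≡ + 84 * (x * (m * y)) + + 27 * (x * y)
    spread = solve-∀
    row : ∀ s → ∑[ t < n ] (w s * w t * (+ 84 * M s t + + 27)) ≡ + 84 * (w s * image w s) + + 27 * (w s * sum w)
    row s = begin
      ∑[ t < n ] (w s * w t * (+ 84 * M s t + + 27))                      ≡⟨ sum-cong-≗ (λ t → spread (w s) (w t) (M s t)) ⟩
      ∑[ t < n ] (+ 84 * (w s * (M s t * w t)) + + 27 * (w s * w t))      ≡⟨ ∑-distrib-+ (λ t → + 84 * (w s * (M s t * w t))) (λ t → + 27 * (w s * w t)) ⟩
      ∑[ t < n ] (+ 84 * (w s * (M s t * w t))) + ∑[ t < n ] (+ 27 * (w s * w t))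
        ≡⟨ cong₂ _+_ (trans (∑-distribˡ-* (+ 84) (λ t → w s * (M s t * w t))) (cong (+ 84 *_) (∑-distribˡ-* (w s) (λ t → M s t * w t))))
                     (trans (∑-distribˡ-* (+ 27) (λ t → w s * w t)) (cong (+ 27 *_) (∑-distribˡ-* (w s) w))) ⟩
      + 84 * (w s * image w s) + + 27 * (w s * sum w)                    ∎
    sum-times : ∀ c → ∑[ s < n ] (w s * c) ≡ c * sum w
    sum-times c = trans (sum-cong-≗ (λ s → ℤP.*-comm (w s) c)) (∑-distribˡ-* c w)

  -- Expand 0 ≤ ∑ᵥ (7 (Mw)ᵥ − ∑ w)² using M² = 84 M + 27 J and 1911 = 7 · 273.
  sum-squared-≤ : ∀ w → sum w * sum w ≤ + 7 * bilinear M w w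
  sum-squared-≤ w = ℤP.0≤i-j⇒j≤i (ℤP.*-cancelˡ-≤-pos 0ℤ (+ 7 * Q - S * S) (+ 588) 0≤588gap)
    where
    open ≡-Reasoning
    S Q : ℤ
    S = sum w
    Q = bilinear M w w
    expand : ∀ x s → (+ 7 * x - s) * (+ 7 * x - s) ≡ + 49 * (x * x) + (- (+ 14) * s) * x + s * s
    expand = solve-∀
    collect : ∀ q s → + 49 * (+ 84 * q + + 27 * (s * s)) + (- (+ 14) * s) * (+ 273 * s) + + 1911 * (s * s) ≡ + 588 * (+ 7 * q - s * s)
    collect = solve-∀
    ∑-constant : ∀ c → ∑[ v < n ] c ≡ + 1911 * c
    ∑-constant c = subst (λ k → ∑[ v < n ] c ≡ + k * c) n≡1911 (∑-const n c)
    deviation : ∑[ v < n ] ((+ 7 * image w v - S) * (+ 7 * image w v - S)) ≡ + 588 * (+ 7 * Q - S * S)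
    deviation = begin
      ∑[ v < n ] ((+ 7 * image w v - S) * (+ 7 * image w v - S))
        ≡⟨ sum-cong-≗ (λ v → expand (image w v) S) ⟩
      ∑[ v < n ] (+ 49 * (image w v * image w v) + (- (+ 14) * S) * image w v + S * S)
        ≡⟨ ∑-distrib-+₃ (λ v → + 49 * (image w v * image w v)) (λ v → (- (+ 14) * S) * image w v) (λ _ → S * S) ⟩
      ∑[ v < n ] (+ 49 * (image w v * image w v)) + ∑[ v < n ] ((- (+ 14) * S) * image w v) + ∑[ v < n ] (S * S)
        ≡⟨ cong₂ _+_ (cong₂ _+_ (∑-distribˡ-* (+ 49) (λ v → image w v * image w v)) (∑-distribˡ-* (- (+ 14) * S) (image w)))
                     (∑-constant (S * S)) ⟩
      + 49 * ∑[ v < n ] (image w v * image w v) + (- (+ 14) * S) * sum (image w) + + 1911 * (S * S)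
        ≡⟨ cong₂ (λ a b → + 49 * a + (- (+ 14) * S) * b + + 1911 * (S * S)) (∑-image² w) (∑-image w) ⟩
      + 49 * (+ 84 * Q + + 27 * (S * S)) + (- (+ 14) * S) * (+ 273 * S) + + 1911 * (S * S)
        ≡⟨ collect Q S ⟩
      + 588 * (+ 7 * Q - S * S) ∎
    0≤588gap : + 588 * 0ℤ ≤ + 588 * (+ 7 * Q - S * S)
    0≤588gap = subst (_≤ + 588 * (+ 7 * Q - S * S)) (sym (ℤP.*-zeroʳ (+ 588)))
                 (subst (0ℤ ≤_) deviation (∑-nonneg (λ v → square-nonneg (+ 7 * image w v - S))))

  form-χ : ∀ U W → bilinear M (χ U) (χ W) ≡ edges G U W + + 3 * + ∣ U ∩ W ∣
  form-χ U W = begin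
    ∑[ s < n ] (χ U s * ∑[ t < n ] (M s t * χ W t))                       ≡⟨ sum-cong-≗ (λ s → cong (χ U s *_) (row s)) ⟩
    ∑[ s < n ] (χ U s * (degIn G W s + + 3 * χ W s))                      ≡⟨ sum-cong-≗ (λ s → spread (χ U s) (degIn G W s) (χ W s)) ⟩
    ∑[ s < n ] (χ U s * degIn G W s + + 3 * (χ U s * χ W s))              ≡⟨ ∑-distrib-+ (λ s → χ U s * degIn G W s) (λ s → + 3 * (χ U s * χ W s)) ⟩
    edges G U W + ∑[ s < n ] (+ 3 * (χ U s * χ W s))                      ≡⟨ cong (_+_ (edges G U W)) (∑-distribˡ-* (+ 3) (λ s → χ U s * χ W s)) ⟩
    edges G U W + + 3 * ∑[ s < n ] (χ U s * χ W s)                        ≡⟨ cong (λ c → edges G U W + + 3 * c) (trans (sum-cong-≗ (λ s → sym (χ-∩ U W s))) (∑-χ (U ∩ W))) ⟩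
    edges G U W + + 3 * + ∣ U ∩ W ∣                                        ∎
    where
    open ≡-Reasoning
    spread : ∀ x d c → x * (d + + 3 * c) ≡ x * d + + 3 * (x * c)
    spread = solve-∀
    split : ∀ a e c → (a + + 3 * e) * c ≡ a * c + + 3 * (e * c)
    split = solve-∀
    row : ∀ s → ∑[ t < n ] (M s t * χ W t) ≡ degIn G W s + + 3 * χ W s
    row s = begin
      ∑[ t < n ] (M s t * χ W t)                                        ≡⟨ sum-cong-≗ (λ t → split (adj G s t) (δ s t) (χ W t)) ⟩
      ∑[ t < n ] (adj G s t * χ W t + + 3 * (δ s t * χ W t))            ≡⟨ ∑-distrib-+ (λ t → adj G s t * χ W t) (λ t → + 3 * (δ s t * χ W t)) ⟩
      degIn G W s + ∑[ t < n ] (+ 3 * (δ s t * χ W t))                  ≡⟨ cong (_+_ (degIn G W s)) (trans (∑-distribˡ-* (+ 3) (λ t → δ s t * χ W t)) (cong (+ 3 *_) (∑-δ s (χ W)))) ⟩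
      degIn G W s + + 3 * χ W s                                         ∎

  form-clique : ∀ {U} → Complete G U U → bilinear M (χ U) (χ U) ≡ + ∣ U ∣ * (+ ∣ U ∣ + + 2)
  form-clique {U} clique = begin
    bilinear M (χ U) (χ U)                                        ≡⟨ form-χ U U ⟩
    edges G U U + + 3 * + ∣ U ∩ U ∣                               ≡⟨ cong (λ c → edges G U U + + 3 * + ∣ c ∣) (∩-idem U) ⟩
    edges G U U + + 3 * + ∣ U ∣                                   ≡⟨ cong (_+ + 3 * + ∣ U ∣) (edges-complete G clique) ⟩
    + ∣ U ∣ * + ∣ U ∣ - + ∣ U ∩ U ∣ + + 3 * + ∣ U ∣               ≡⟨ cong (λ c → + ∣ U ∣ * + ∣ U ∣ - + ∣ c ∣ + + 3 * + ∣ U ∣) (∩-idem U) ⟩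
    + ∣ U ∣ * + ∣ U ∣ - + ∣ U ∣ + + 3 * + ∣ U ∣                   ≡⟨ collect (+ ∣ U ∣) ⟩
    + ∣ U ∣ * (+ ∣ U ∣ + + 2)                                     ∎
    where
    open ≡-Reasoning
    collect : ∀ c → c * c - c + + 3 * c ≡ c * (c + + 2)
    collect = solve-∀

  form-cross : ∀ {U W} → Complete G U W → Empty (U ∩ W) → bilinear M (χ U) (χ W) ≡ + ∣ W ∣ * + ∣ U ∣
  form-cross {U} {W} complete U∩W-empty = begin
    bilinear M (χ U) (χ W)                                        ≡⟨ form-χ U W ⟩
    edges G U W + + 3 * + ∣ U ∩ W ∣                               ≡⟨ cong (_+ + 3 * + ∣ U ∩ W ∣) (edges-complete G complete) ⟩
    + ∣ W ∣ * + ∣ U ∣ - + ∣ U ∩ W ∣ + + 3 * + ∣ U ∩ W ∣           ≡⟨ cong (λ c → + ∣ W ∣ * + ∣ U ∣ - + c + + 3 * + c) (∣Empty∣≡0 U∩W-empty) ⟩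
    + ∣ W ∣ * + ∣ U ∣ - 0ℤ + + 3 * 0ℤ                             ≡⟨ vanish (+ ∣ W ∣ * + ∣ U ∣) ⟩
    + ∣ W ∣ * + ∣ U ∣                                             ∎
    where
    open ≡-Reasoning
    vanish : ∀ c → c - 0ℤ + + 3 * 0ℤ ≡ c
    vanish = solve-∀

  form-disjoint : ∀ {U W} → Empty (U ∩ W) → bilinear M (χ U) (χ W) ≡ edges G U W
  form-disjoint {U} {W} U∩W-empty = begin
    bilinear M (χ U) (χ W)                 ≡⟨ form-χ U W ⟩
    edges G U W + + 3 * + ∣ U ∩ W ∣        ≡⟨ cong (λ c → edges G U W + + 3 * + c) (∣Empty∣≡0 U∩W-empty) ⟩
    edges G U W + + 3 * 0ℤ                 ≡⟨ ℤP.+-identityʳ (edges G U W) ⟩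
    edges G U W                            ∎
    where open ≡-Reasoning

  partition-inequality : ∀ {A B I} → OverlappingCliques G A B I → PartitionInequality (+ ∣ I ∣) (+ ∣ A ∣) (+ ∣ B ∣) (edges G A B)
  partition-inequality {A} {B} {I} ov x y z = subst₂ (λ s f → s * s ≤ + 7 * f) sum-w form-w (sum-squared-≤ w)
    where
    open OverlappingCliques ov
    open ≡-Reasoning
    p q m E : ℤ
    p = + ∣ A ∣
    q = + ∣ B ∣
    m = + ∣ I ∣
    E = edges G A B
    F : Subset n → Subset n → ℤ
    F U W = bilinear M (χ U) (χ W)
    w : Fin n → ℤ
    w s = x * χ A s + y * χ B s + z * χ I s
    combine : ∀ {a a′ b b′ c c′} → a ≡ a′ → b ≡ b′ → c ≡ c′ → x * a + y * b + z * c ≡ x * a′ + y * b′ + z * c′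
    combine refl refl refl = refl
    sum-w : sum w ≡ partitionSum m p q x y z
    sum-w = trans (∑-distrib-+₃ (λ s → x * χ A s) (λ s → y * χ B s) (λ s → z * χ I s))
                  (combine′ (trans (∑-distribˡ-* x (χ A)) (cong (x *_) (∑-χ A)))
                            (trans (∑-distribˡ-* y (χ B)) (cong (y *_) (∑-χ B)))
                            (trans (∑-distribˡ-* z (χ I)) (cong (z *_) (∑-χ I))))
      where
      combine′ : ∀ {a a′ b b′ c c′ : ℤ} → a ≡ a′ → b ≡ b′ → c ≡ c′ → a + b + c ≡ a′ + b′ + c′
      combine′ refl refl refl = refl
    against : ∀ U → bilinear M (χ U) w ≡ x * F A U + y * F B U + z * F I U
    against U = trans (bilinear-sym M-sym (χ U) w) (bilinear-linearˡ M x y z (χ A) (χ B) (χ I) (χ U))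
    row-A : bilinear M (χ A) w ≡ x * (p * (p + + 2)) + y * E + z * (p * m)
    row-A = trans (against A) (combine (form-clique A-clique)
                                       (trans (form-disjoint (Empty∩-sym A∩B-empty)) (edges-sym G B A))
                                       (form-cross (Complete-sym G A-I) (Empty∩-sym A∩I-empty)))
    row-B : bilinear M (χ B) w ≡ x * E + y * (q * (q + + 2)) + z * (q * m)
    row-B = trans (against B) (combine (form-disjoint A∩B-empty) (form-clique B-clique)
                                       (form-cross (Complete-sym G B-I) (Empty∩-sym B∩I-empty)))
    row-I : bilinear M (χ I) w ≡ x * (m * p) + y * (m * q) + z * (m * (m + + 2))
    row-I = trans (against I) (combine (form-cross A-I A∩I-empty) (form-cross B-I B∩I-empty) (form-clique I-clique))
    assemble : ∀ m p q E x y z →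
      x * (x * (p * (p + + 2)) + y * E + z * (p * m)) + y * (x * E + y * (q * (q + + 2)) + z * (q * m))
        + z * (x * (m * p) + y * (m * q) + z * (m * (m + + 2)))
      ≡ x * x * (p * (p + + 2)) + y * y * (q * (q + + 2)) + z * z * (m * (m + + 2))
        + + 2 * x * z * p * m + + 2 * y * z * q * m + + 2 * x * y * E
    assemble = solve-∀
    form-w : bilinear M w w ≡ partitionForm m p q E x y z
    form-w = trans (bilinear-linearˡ M x y z (χ A) (χ B) (χ I) w) (trans (combine row-A row-B row-I) (assemble m p q E x y z))

-- Two cliques with a large intersection
module Analysis {n : ℕ} (n≡1911 : n ≡ 1911) (G : SimpleGraph n) (srg : IsSRG G 270 105 27) where
  open SimpleGraph G using (Adj; Adj?) renaming (sym to Adj-sym)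
  open IsSRG srg using (nonadjCommon)
  open SRG n≡1911 G srg

  ∣I∣+∣A∣≤107 : ∀ {A B I s i} → OverlappingCliques G A B I → s ∈ A → i ∈ I → ∣ I ∣ ℕ.+ ∣ A ∣ ℕ.≤ 107
  ∣I∣+∣A∣≤107 {A} {B} {I} ov s∈A i∈I =
    subst (ℕ._≤ 107) (trans (∣∪∣≡∣∣+∣∣ A∩I-empty) (ℕP.+-comm ∣ A ∣ ∣ I ∣))
      (clique-card-≤-107 (Complete-∪ G A-clique I-clique A-I) (x∈p∪q⁺ (inj₁ s∈A)) (x∈p∪q⁺ (inj₂ i∈I))
                         λ { refl → Empty∩⇒∉ A∩I-empty s∈A i∈I })
    where open OverlappingCliques ov

  -- Otherwise the weights (12, 5, −2) on ({s}, B, I) break the partition inequality.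
  has-neighbour : ∀ {A B I} → OverlappingCliques G A B I → ∣ I ∣ ≡ 22 → ∣ B ∣ ≡ 7 → ∀ {s} → s ∈ A → 1ℤ ≤ degIn G B s
  has-neighbour {A} {B} {I} ov ∣I∣≡22 ∣B∣≡7 {s} s∈A with ∣ N G s ∩ B ∣ in ∣Ns∩B∣≡
  ... | suc _ = subst (1ℤ ≤_) (sym (trans (degIn-card G B s) (cong +_ ∣Ns∩B∣≡))) (ℤ.+≤+ (ℕ.s≤s ℕ.z≤n))
  ... | zero = ⊥-elim (not-violated {+ 22} {1ℤ} {+ 7} {0ℤ} {0ℤ} {+ 12} {+ 5} { - + 2 }
                         star-inequality (ℤ.+≤+ ℕ.z≤n) (ℤ.+≤+ ℕ.z≤n) ℤP.≤-refl star-violation)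
    where
    ⁅s⁆⊆A : ⁅ s ⁆ ⊆ A
    ⁅s⁆⊆A v∈⁅s⁆ = subst (_∈ A) (sym (x∈⁅y⁆⇒x≡y s v∈⁅s⁆)) s∈A
    star-inequality : PartitionInequality (+ 22) 1ℤ (+ 7) 0ℤ
    star-inequality = PartitionInequality-resp (cong +_ ∣I∣≡22) (cong +_ (∣⁅x⁆∣≡1 s)) (cong +_ ∣B∣≡7)
                        (trans (edges-⁅⁆ G s B) (trans (degIn-card G B s) (cong +_ ∣Ns∩B∣≡)))
                        (partition-inequality (shrink-overlap G ⁅s⁆⊆A ov))
    star-violation : Violates (+ 22) 1ℤ (+ 7) 0ℤ (+ 12) (+ 5) (- + 2)
    star-violation = Violatesℕ⇒Violates {22} {1} {7} {0} {12} {5} {2} (toWitness {a? = violatesℕ? 22 1 7 0 12 5 2} _)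

  module Overlap {A B I : Subset n} (ov : OverlappingCliques G A B I) where
    open OverlappingCliques ov

    -- I, N(t) ∩ A and N(s) ∩ B are disjoint sets of common neighbours of s and t.
    common-neighbours-≤ : ∀ {s t} → s ∈ A → t ∈ B → ¬ Adj s t → (+ ∣ I ∣) + degIn G A t + degIn G B s ≤ + 27
    common-neighbours-≤ {s} {t} s∈A t∈B ¬st = subst (_≤ + 27) as-degrees (ℤ.+≤+ counted)
      where
      Nt∩A Ns∩B : Subset n
      Nt∩A = N G t ∩ A
      Ns∩B = N G s ∩ B
      s≢t : s ≢ t
      s≢t refl = Empty∩⇒∉ A∩B-empty s∈A t∈B
      Nt∩A∩Ns∩B-empty : Empty (Nt∩A ∩ Ns∩B)
      Nt∩A∩Ns∩B-empty (u , u∈) with x∈p∩q⁻ Nt∩A Ns∩B u∈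
      ... | u∈Nt∩A , u∈Ns∩B = Empty∩⇒∉ A∩B-empty (proj₂ (x∈p∩q⁻ (N G t) A u∈Nt∩A)) (proj₂ (x∈p∩q⁻ (N G s) B u∈Ns∩B))
      I∩rest-empty : Empty (I ∩ (Nt∩A ∪ Ns∩B))
      I∩rest-empty (u , u∈) with x∈p∩q⁻ I (Nt∩A ∪ Ns∩B) u∈
      ... | u∈I , u∈rest with x∈p∪q⁻ Nt∩A Ns∩B u∈rest
      ...   | inj₁ u∈Nt∩A = Empty∩⇒∉ A∩I-empty (proj₂ (x∈p∩q⁻ (N G t) A u∈Nt∩A)) u∈I
      ...   | inj₂ u∈Ns∩B = Empty∩⇒∉ B∩I-empty (proj₂ (x∈p∩q⁻ (N G s) B u∈Ns∩B)) u∈I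
      common : I ∪ Nt∩A ∪ Ns∩B ⊆ N G s ∩ N G t
      common {u} u∈ with x∈p∪q⁻ I (Nt∩A ∪ Ns∩B) u∈
      ... | inj₁ u∈I = x∈p∩q⁺ ( ∈N⁺ G (A-I s∈A u∈I λ { refl → Empty∩⇒∉ A∩I-empty s∈A u∈I })
                              , ∈N⁺ G (B-I t∈B u∈I λ { refl → Empty∩⇒∉ B∩I-empty t∈B u∈I }))
      ... | inj₂ u∈rest with x∈p∪q⁻ Nt∩A Ns∩B u∈rest
      ...   | inj₁ u∈Nt∩A with x∈p∩q⁻ (N G t) A u∈Nt∩A
      ...     | u∈Nt , u∈A = x∈p∩q⁺ (∈N⁺ G (A-clique s∈A u∈A λ { refl → ¬st (Adj-sym (∈N⁻ G u∈Nt)) }) , u∈Nt)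
      common {u} u∈ | inj₂ u∈rest | inj₂ u∈Ns∩B with x∈p∩q⁻ (N G s) B u∈Ns∩B
      ...     | u∈Ns , u∈B = x∈p∩q⁺ (u∈Ns , ∈N⁺ G (B-clique t∈B u∈B λ { refl → ¬st (∈N⁻ G u∈Ns) }))
      counted : ∣ I ∣ ℕ.+ (∣ Nt∩A ∣ ℕ.+ ∣ Ns∩B ∣) ℕ.≤ 27
      counted = begin
        ∣ I ∣ ℕ.+ (∣ Nt∩A ∣ ℕ.+ ∣ Ns∩B ∣)     ≡⟨ cong (ℕ._+_ ∣ I ∣) (∣∪∣≡∣∣+∣∣ Nt∩A∩Ns∩B-empty) ⟨
        ∣ I ∣ ℕ.+ ∣ Nt∩A ∪ Ns∩B ∣             ≡⟨ ∣∪∣≡∣∣+∣∣ I∩rest-empty ⟨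
        ∣ I ∪ Nt∩A ∪ Ns∩B ∣                   ≤⟨ p⊆q⇒∣p∣≤∣q∣ common ⟩
        ∣ N G s ∩ N G t ∣                     ≡⟨ nonadjCommon s t s≢t ¬st ⟩
        27                                    ∎
        where open ℕP.≤-Reasoning
      as-degrees : + (∣ I ∣ ℕ.+ (∣ Nt∩A ∣ ℕ.+ ∣ Ns∩B ∣)) ≡ (+ ∣ I ∣) + degIn G A t + degIn G B s
      as-degrees = begin
        + (∣ I ∣ ℕ.+ (∣ Nt∩A ∣ ℕ.+ ∣ Ns∩B ∣))   ≡⟨ trans (ℤP.pos-+ ∣ I ∣ _) (cong (_+_ (+ ∣ I ∣)) (ℤP.pos-+ ∣ Nt∩A ∣ ∣ Ns∩B ∣)) ⟩
        (+ ∣ I ∣) + (+ ∣ Nt∩A ∣ + + ∣ Ns∩B ∣)           ≡⟨ ℤP.+-assoc (+ ∣ I ∣) (+ ∣ Nt∩A ∣) (+ ∣ Ns∩B ∣) ⟨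
        (+ ∣ I ∣) + + ∣ Nt∩A ∣ + + ∣ Ns∩B ∣             ≡⟨ cong₂ (λ a b → (+ ∣ I ∣) + a + b) (degIn-card G A t) (degIn-card G B s) ⟨
        (+ ∣ I ∣) + degIn G A t + degIn G B s           ∎
        where open ≡-Reasoning

    degIn-B-≤ : NoneCompleteTo G A B → ∀ {s} → s ∈ A → degIn G B s ≤ (deficit ∣ I ∣)
    degIn-B-≤ A↛B s∈A with A↛B s∈A
    ... | t , t∈B , ¬st = ≤-from-gap _ (ℤP.+-mono-≤ (ℤP.i≤j⇒0≤j-i (common-neighbours-≤ s∈A t∈B ¬st)) (degIn-nonneg G A t))
                                       (slack (+ ∣ I ∣) (degIn G A t) (degIn G B _))
      where
      slack : ∀ m α β → + 27 - m - β ≡ + 27 - (m + α + β) + α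
      slack = solve-∀

    degIn-A-≤ : NoneCompleteTo G B A → ∀ {t} → t ∈ B → degIn G A t ≤ (deficit ∣ I ∣)
    degIn-A-≤ B↛A t∈B with B↛A t∈B
    ... | s , s∈A , ¬ts = ≤-from-gap _ (ℤP.+-mono-≤ (ℤP.i≤j⇒0≤j-i (common-neighbours-≤ s∈A t∈B (¬ts ∘ Adj-sym))) (degIn-nonneg G B s))
                                       (slack (+ ∣ I ∣) (degIn G A _) (degIn G B s))
      where
      slack : ∀ m α β → + 27 - m - α ≡ + 27 - (m + α + β) + β
      slack = solve-∀

    ∣I∣≤27 : NoneCompleteTo G A B → Nonempty A → ∣ I ∣ ℕ.≤ 27
    ∣I∣≤27 A↛B (s , s∈A) with A↛B s∈A
    ... | t , t∈B , ¬st = ℤP.drop‿+≤+ (≤-from-gap _ nonneg (slack (+ ∣ I ∣) (degIn G A t) (degIn G B s)))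
      where
      slack : ∀ m α β → + 27 - m ≡ + 27 - (m + α + β) + α + β
      slack = solve-∀
      nonneg : 0ℤ ≤ + 27 - ((+ ∣ I ∣) + degIn G A t + degIn G B s) + degIn G A t + degIn G B s
      nonneg = ℤP.+-mono-≤ (ℤP.+-mono-≤ (ℤP.i≤j⇒0≤j-i (common-neighbours-≤ s∈A t∈B ¬st)) (degIn-nonneg G A t)) (degIn-nonneg G B s)

    nonAdj : Fin n → Fin n → ℤ
    nonAdj s t = χ A s * χ B t * (1ℤ - adj G s t)

    nonAdj-weight-≤ : ∀ s t → nonAdj s t * ((+ ∣ I ∣) + degIn G A t + degIn G B s) ≤ nonAdj s t * + 27
    nonAdj-weight-≤ s t with s ∈? A | t ∈? B
    ... | no s∉A | _ rewrite χ-∉ s∉A = ℤP.≤-refl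
    ... | yes s∈A | no t∉B rewrite χ-∈ s∈A | χ-∉ t∉B = ℤP.≤-refl
    ... | yes s∈A | yes t∈B rewrite χ-∈ s∈A | χ-∈ t∈B with Adj? s t
    ...   | yes _ = ℤP.≤-refl
    ...   | no ¬st = ℤP.*-monoˡ-≤-nonNeg 1ℤ (common-neighbours-≤ s∈A t∈B ¬st)

    ∑-nonAdj-t : ∀ g → ∑[ s < n ] ∑[ t < n ] (nonAdj s t * g t) ≡ ∑[ t < n ] (χ B t * g t * ((+ ∣ A ∣) - degIn G A t))
    ∑-nonAdj-t g = trans (∑-comm (λ s t → nonAdj s t * g t)) (trans (sum-cong-≗ (λ t → sum-cong-≗ (λ s → transpose s t))) (∑-nonadjacent G B A g))
      where
      reorder : ∀ x y a c → x * y * (1ℤ - a) * c ≡ y * x * (1ℤ - a) * c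
      reorder = solve-∀
      transpose : ∀ s t → nonAdj s t * g t ≡ χ B t * χ A s * (1ℤ - adj G t s) * g t
      transpose s t = trans (reorder (χ A s) (χ B t) (adj G s t) (g t)) (cong (λ a → χ B t * χ A s * (1ℤ - a) * g t) (adj-sym G s t))

    nonAdj-count : ∑[ s < n ] ∑[ t < n ] nonAdj s t ≡ (+ ∣ A ∣) * (+ ∣ B ∣) - edges G A B
    nonAdj-count = begin
      ∑[ s < n ] ∑[ t < n ] nonAdj s t                            ≡⟨ sum-cong-≗ (λ s → sum-cong-≗ (λ t → sym (ℤP.*-identityʳ (nonAdj s t)))) ⟩
      ∑[ s < n ] ∑[ t < n ] (nonAdj s t * 1ℤ)                     ≡⟨ ∑-nonadjacent G A B (λ _ → 1ℤ) ⟩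
      ∑[ s < n ] (χ A s * 1ℤ * ((+ ∣ B ∣) - degIn G B s))                 ≡⟨ sum-cong-≗ (λ s → spread (χ A s) (degIn G B s) (+ ∣ B ∣)) ⟩
      ∑[ s < n ] ((+ ∣ B ∣) * χ A s - χ A s * degIn G B s)                ≡⟨ ∑-distrib-- (λ s → (+ ∣ B ∣) * χ A s) (λ s → χ A s * degIn G B s) ⟩
      ∑[ s < n ] ((+ ∣ B ∣) * χ A s) - edges G A B                                  ≡⟨ cong (_- edges G A B) (trans (∑-distribˡ-* (+ ∣ B ∣) (χ A)) (trans (cong ((+ ∣ B ∣) *_) (∑-χ A)) (ℤP.*-comm (+ ∣ B ∣) (+ ∣ A ∣)))) ⟩
      (+ ∣ A ∣) * (+ ∣ B ∣) - edges G A B                                                   ∎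
      where
      open ≡-Reasoning
      spread : ∀ x b q → x * 1ℤ * (q - b) ≡ q * x - x * b
      spread = solve-∀

    -- Sum the common-neighbour bound over the non-adjacent pairs of A × B, and bound each
    -- β (q − β) from below using c ≤ β ≤ 27 − m, where β is the degree into the other side.
    edge-count-bound : NoneCompleteTo G A B → NoneCompleteTo G B A → ∀ c →
      (∀ {s} → s ∈ A → c ≤ degIn G B s) → (∀ {t} → t ∈ B → c ≤ degIn G A t) →
      ((+ ∣ A ∣) + (+ ∣ B ∣) - (deficit ∣ I ∣) - + 2 * c) * edges G A B + c * (deficit ∣ I ∣) * ((+ ∣ A ∣) + (+ ∣ B ∣)) ≤ (deficit ∣ I ∣) * ((+ ∣ A ∣) * (+ ∣ B ∣))
    edge-count-bound A↛B B↛A c c≤β c≤α = ≤-from-gap _ nonneg (slack (+ ∣ I ∣) (+ ∣ A ∣) (+ ∣ B ∣) (edges G A B) P-A P-B c)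
      where
      open ≡-Reasoning
      nonEdges P-A P-B : ℤ
      nonEdges = (+ ∣ A ∣) * (+ ∣ B ∣) - edges G A B
      P-A = ∑[ s < n ] (χ A s * degIn G B s * ((+ ∣ B ∣) - degIn G B s))
      P-B = ∑[ t < n ] (χ B t * degIn G A t * ((+ ∣ A ∣) - degIn G A t))
      expand : ∀ x m α β → x * (m + α + β) ≡ m * x + x * α + x * β
      expand = solve-∀
      weighted : ∑[ s < n ] ∑[ t < n ] (nonAdj s t * ((+ ∣ I ∣) + degIn G A t + degIn G B s)) ≡ (+ ∣ I ∣) * nonEdges + P-B + P-A
      weighted = begin
        ∑[ s < n ] ∑[ t < n ] (nonAdj s t * ((+ ∣ I ∣) + degIn G A t + degIn G B s))
          ≡⟨ sum-cong-≗ (λ s → trans (sum-cong-≗ (λ t → expand (nonAdj s t) (+ ∣ I ∣) (degIn G A t) (degIn G B s)))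
                                     (∑-distrib-+₃ (λ t → (+ ∣ I ∣) * nonAdj s t) (λ t → nonAdj s t * degIn G A t) (λ t → nonAdj s t * degIn G B s))) ⟩
        ∑[ s < n ] (∑[ t < n ] ((+ ∣ I ∣) * nonAdj s t) + ∑[ t < n ] (nonAdj s t * degIn G A t) + ∑[ t < n ] (nonAdj s t * degIn G B s))
          ≡⟨ ∑-distrib-+₃ (λ s → ∑[ t < n ] ((+ ∣ I ∣) * nonAdj s t)) (λ s → ∑[ t < n ] (nonAdj s t * degIn G A t)) (λ s → ∑[ t < n ] (nonAdj s t * degIn G B s)) ⟩
        ∑[ s < n ] ∑[ t < n ] ((+ ∣ I ∣) * nonAdj s t) + ∑[ s < n ] ∑[ t < n ] (nonAdj s t * degIn G A t) + ∑[ s < n ] ∑[ t < n ] (nonAdj s t * degIn G B s)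
          ≡⟨ cong₂ _+_ (cong₂ _+_ (trans (sum-cong-≗ (λ s → ∑-distribˡ-* (+ ∣ I ∣) (nonAdj s))) (trans (∑-distribˡ-* (+ ∣ I ∣) (λ s → sum (nonAdj s))) (cong ((+ ∣ I ∣) *_) nonAdj-count)))
                                  (∑-nonAdj-t (degIn G A)))
                       (∑-nonadjacent G A B (degIn G B)) ⟩
        (+ ∣ I ∣) * nonEdges + P-B + P-A ∎
      scaled : ∑[ s < n ] ∑[ t < n ] (nonAdj s t * + 27) ≡ + 27 * nonEdges
      scaled = begin
        ∑[ s < n ] ∑[ t < n ] (nonAdj s t * + 27)  ≡⟨ sum-cong-≗ (λ s → trans (sum-cong-≗ (λ t → ℤP.*-comm (nonAdj s t) (+ 27))) (∑-distribˡ-* (+ 27) (nonAdj s))) ⟩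
        ∑[ s < n ] (+ 27 * sum (nonAdj s))          ≡⟨ ∑-distribˡ-* (+ 27) (λ s → sum (nonAdj s)) ⟩
        + 27 * ∑[ s < n ] ∑[ t < n ] nonAdj s t    ≡⟨ cong (+ 27 *_) nonAdj-count ⟩
        + 27 * nonEdges                                   ∎
      counted : (+ ∣ I ∣) * nonEdges + P-B + P-A ≤ + 27 * nonEdges
      counted = subst₂ _≤_ weighted scaled (∑-mono-≤ (λ s → ∑-mono-≤ (λ t → nonAdj-weight-≤ s t)))
      lower-A : ((+ ∣ B ∣) - (deficit ∣ I ∣) - c) * edges G A B + c * (deficit ∣ I ∣) * (+ ∣ A ∣) ≤ P-A
      lower-A = ∑-quadratic-≥ A (degIn G B) (+ ∣ B ∣) c (deficit ∣ I ∣) c≤β (degIn-B-≤ A↛B)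
      lower-B : ((+ ∣ A ∣) - (deficit ∣ I ∣) - c) * edges G A B + c * (deficit ∣ I ∣) * (+ ∣ B ∣) ≤ P-B
      lower-B = subst (λ e → ((+ ∣ A ∣) - (deficit ∣ I ∣) - c) * e + c * (deficit ∣ I ∣) * (+ ∣ B ∣) ≤ P-B) (edges-sym G B A) (∑-quadratic-≥ B (degIn G A) (+ ∣ A ∣) c (deficit ∣ I ∣) c≤α (degIn-A-≤ B↛A))
      nonneg : 0ℤ ≤ + 27 * nonEdges - ((+ ∣ I ∣) * nonEdges + P-B + P-A) + (P-B - (((+ ∣ A ∣) - (deficit ∣ I ∣) - c) * edges G A B + c * (deficit ∣ I ∣) * (+ ∣ B ∣))) + (P-A - (((+ ∣ B ∣) - (deficit ∣ I ∣) - c) * edges G A B + c * (deficit ∣ I ∣) * (+ ∣ A ∣)))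
      nonneg = ℤP.+-mono-≤ (ℤP.+-mono-≤ (ℤP.i≤j⇒0≤j-i counted) (ℤP.i≤j⇒0≤j-i lower-B)) (ℤP.i≤j⇒0≤j-i lower-A)
      slack : ∀ m p q e PA PB c →
        (+ 27 - m) * (p * q) - ((p + q - (+ 27 - m) - + 2 * c) * e + c * (+ 27 - m) * (p + q))
          ≡ + 27 * (p * q - e) - (m * (p * q - e) + PB + PA) + (PB - ((p - (+ 27 - m) - c) * e + c * (+ 27 - m) * q))
            + (PA - ((q - (+ 27 - m) - c) * e + c * (+ 27 - m) * p))
      slack = solve-∀

    overlap-sizes : NoneCompleteTo G A B → NoneCompleteTo G B A → Nonempty A →
      22 ℕ.≤ ∣ I ∣ → 29 ℕ.≤ ∣ I ∣ ℕ.+ ∣ A ∣ → 29 ℕ.≤ ∣ I ∣ ℕ.+ ∣ B ∣ → ∣ I ∣ ≡ 27 × ∣ A ∣ ≡ 2 × ∣ B ∣ ≡ 2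
    overlap-sizes A↛B B↛A A-nonempty@(s₀ , s₀∈A) 22≤∣I∣ 29≤∣I∣+∣A∣ 29≤∣I∣+∣B∣ =
      conclude (exceptional-sizes {∣ I ∣} {∣ A ∣} {∣ B ∣} {edges G A B} 22≤∣I∣ (∣I∣≤27 A↛B A-nonempty) admissible edge-bound (partition-inequality ov))
      where
      t₀∈B : proj₁ (A↛B s₀∈A) ∈ B
      t₀∈B = proj₁ (proj₂ (A↛B s₀∈A))
      I-nonempty : Nonempty I
      I-nonempty = ∣∣>0⇒Nonempty (ℕP.≤-trans (ℕ.s≤s ℕ.z≤n) 22≤∣I∣)
      admissible : Admissible (∣ I ∣) (∣ A ∣) (∣ B ∣)
      admissible = 29≤∣I∣+∣A∣ , 29≤∣I∣+∣B∣ , ∣I∣+∣A∣≤107 ov s₀∈A (proj₂ I-nonempty) , ∣I∣+∣A∣≤107 (swap-overlap G ov) t₀∈B (proj₂ I-nonempty)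
      drop-zero : ∀ p q k e → (p + q - k - + 2 * 0ℤ) * e + 0ℤ * k * (p + q) ≡ (p + q - k) * e
      drop-zero = solve-∀
      edge-bound : ((+ ∣ A ∣) + (+ ∣ B ∣) - (deficit ∣ I ∣)) * edges G A B ≤ (deficit ∣ I ∣) * ((+ ∣ A ∣) * (+ ∣ B ∣))
      edge-bound = subst (_≤ (deficit ∣ I ∣) * ((+ ∣ A ∣) * (+ ∣ B ∣))) (drop-zero (+ ∣ A ∣) (+ ∣ B ∣) (deficit ∣ I ∣) (edges G A B))
                     (edge-count-bound A↛B B↛A 0ℤ (λ {s} _ → degIn-nonneg G B s) (λ {t} _ → degIn-nonneg G A t))
      conclude : Exceptional (∣ I ∣) (∣ A ∣) (∣ B ∣) → ∣ I ∣ ≡ 27 × ∣ A ∣ ≡ 2 × ∣ B ∣ ≡ 2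
      conclude (inj₁ sizes) = sizes
      -- Here every vertex of A ∪ B has a neighbour across, so c = 1 in the edge count gives
      -- E ≤ 25, which the weights (2, 2, −1) refute.
      conclude (inj₂ (∣I∣≡22 , ∣A∣≡7 , ∣B∣≡7)) =
        ⊥-elim (not-violated {+ 22} {+ 7} {+ 7} {edges G A B} {+ 25} {+ 2} {+ 2} { - + 1 } (PartitionInequality-resp (cong +_ ∣I∣≡22) (cong +_ ∣A∣≡7) (cong +_ ∣B∣≡7) refl (partition-inequality ov))
                             (ℤ.+≤+ ℕ.z≤n) (ℤ.+≤+ ℕ.z≤n) few-edges pair-violation)
        where
        at-most-25 : ∀ {a b c} → a ≡ 22 → b ≡ 7 → c ≡ 7 →
          (+ b + + c - deficit a - + 2 * 1ℤ) * edges G A B + 1ℤ * deficit a * (+ b + + c) ≤ deficit a * (+ b * + c) → edges G A B ≤ + 25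
        at-most-25 refl refl refl bound = ℤP.*-cancelˡ-≤-pos (edges G A B) (+ 25) (+ 7) (≤-from-gap _ (ℤP.i≤j⇒0≤j-i bound) (slack (edges G A B)))
          where
          slack : ∀ e → + 7 * + 25 - + 7 * e ≡ + 245 - (+ 7 * e + + 70)
          slack = solve-∀
        few-edges : edges G A B ≤ + 25
        few-edges = at-most-25 ∣I∣≡22 ∣A∣≡7 ∣B∣≡7
          (edge-count-bound A↛B B↛A 1ℤ (has-neighbour ov ∣I∣≡22 ∣B∣≡7) (has-neighbour (swap-overlap G ov) ∣I∣≡22 ∣A∣≡7))
        pair-violation : Violates (+ 22) (+ 7) (+ 7) (+ 25) (+ 2) (+ 2) (- + 1)
        pair-violation = Violatesℕ⇒Violates {22} {7} {7} {25} {2} {2} {1} (toWitness {a? = violatesℕ? 22 7 7 25 2 2 1} _)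

  -- An extending vertex lies in B, or enlarges I (if complete to B) or A (otherwise);
  -- the last two contradict |I| = 27 and |A| = 2 for the enlarged configuration.
  A∪I-unextendable : ∀ {A B I} → OverlappingCliques G A B I → NoneCompleteTo G A B → NoneCompleteTo G B A → Nonempty A →
    22 ℕ.≤ ∣ I ∣ → 29 ℕ.≤ ∣ I ∣ ℕ.+ ∣ A ∣ → 29 ℕ.≤ ∣ I ∣ ℕ.+ ∣ B ∣ → ∀ {v} → v ∉ A ∪ I → ¬ CompleteTo G v (A ∪ I)
  A∪I-unextendable {A} {B} {I} ov A↛B B↛A A-nonempty@(s₀ , s₀∈A) 22≤∣I∣ 29≤∣I∣+∣A∣ 29≤∣I∣+∣B∣ {v} v∉A∪I v→A∪I = extend (v ∈? B)
    where
    sizes : ∣ I ∣ ≡ 27 × ∣ A ∣ ≡ 2 × ∣ B ∣ ≡ 2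
    sizes = Overlap.overlap-sizes ov A↛B B↛A A-nonempty 22≤∣I∣ 29≤∣I∣+∣A∣ 29≤∣I∣+∣B∣
    v∉A : v ∉ A
    v∉A = v∉A∪I ∘ x∈p∪q⁺ ∘ inj₁
    v∉I : v ∉ I
    v∉I = v∉A∪I ∘ x∈p∪q⁺ ∘ inj₂
    v→A : CompleteTo G v A
    v→A = v→A∪I ∘ x∈p∪q⁺ ∘ inj₁
    v→I : CompleteTo G v I
    v→I = v→A∪I ∘ x∈p∪q⁺ ∘ inj₂
    extend : Dec (v ∈ B) → ⊥
    extend (yes v∈B) with B↛A v∈B
    ... | s , s∈A , ¬vs = ¬vs (v→A s∈A)
    extend (no v∉B) = extend-outside (completeTo? G v B)
      where
      extend-outside : Dec (CompleteTo G v B) → ⊥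
      extend-outside (yes v→B) = ℕP.1+n≢n (trans (sym (∣∪⁅⁆∣ v∉I)) (trans ∣I′∣≡27 (sym (proj₁ sizes))))
        where
        ∣I′∣≡27 : ∣ I ∪ ⁅ v ⁆ ∣ ≡ 27
        ∣I′∣≡27 = proj₁ (Overlap.overlap-sizes (grow-shared G ov v∉A v∉B v∉I v→A v→B v→I) A↛B B↛A A-nonempty
                           (subst (22 ℕ.≤_) (sym (∣∪⁅⁆∣ v∉I)) (ℕP.m≤n⇒m≤1+n 22≤∣I∣))
                           (subst (λ c → 29 ℕ.≤ c ℕ.+ ∣ A ∣) (sym (∣∪⁅⁆∣ v∉I)) (ℕP.m≤n⇒m≤1+n 29≤∣I∣+∣A∣))
                           (subst (λ c → 29 ℕ.≤ c ℕ.+ ∣ B ∣) (sym (∣∪⁅⁆∣ v∉I)) (ℕP.m≤n⇒m≤1+n 29≤∣I∣+∣B∣)))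
      extend-outside (no ¬v→B) = ℕP.1+n≢n (trans (sym (∣∪⁅⁆∣ v∉A)) (trans ∣A′∣≡2 (sym (proj₁ (proj₂ sizes)))))
        where
        A′↛B : NoneCompleteTo G (A ∪ ⁅ v ⁆) B
        A′↛B s∈A′ with x∈p∪q⁻ A ⁅ v ⁆ s∈A′
        ... | inj₁ s∈A = A↛B s∈A
        ... | inj₂ s∈⁅v⁆ rewrite x∈⁅y⁆⇒x≡y v s∈⁅v⁆ = nonNeighbour G ¬v→B
        B↛A′ : NoneCompleteTo G B (A ∪ ⁅ v ⁆)
        B↛A′ t∈B with B↛A t∈B
        ... | s , s∈A , ¬ts = s , x∈p∪q⁺ (inj₁ s∈A) , ¬ts
        ∣A′∣≡2 : ∣ A ∪ ⁅ v ⁆ ∣ ≡ 2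
        ∣A′∣≡2 = proj₁ (proj₂ (Overlap.overlap-sizes (grow-private G ov v∉B v∉I v→A v→I) A′↛B B↛A′ (s₀ , x∈p∪q⁺ (inj₁ s₀∈A))
                           22≤∣I∣
                           (subst (λ c → 29 ℕ.≤ ∣ I ∣ ℕ.+ c) (sym (∣∪⁅⁆∣ v∉A)) (ℕP.≤-trans (ℕP.m≤n⇒m≤1+n 29≤∣I∣+∣A∣) (ℕP.≤-reflexive (sym (ℕP.+-suc ∣ I ∣ ∣ A ∣)))))
                           29≤∣I∣+∣B∣))

  undominated-cliques : ∀ {C₁ C₂} → IsClique G C₁ → IsClique G C₂ → C₁ ≢ C₂ →
    ∣ C₁ ∣ ≥ 29 → ∣ C₂ ∣ ≥ 29 → ∣ C₁ ∩ C₂ ∣ ≥ 22 →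
    NoneCompleteTo G (C₁ ─ C₂) (C₂ ─ C₁) → NoneCompleteTo G (C₂ ─ C₁) (C₁ ─ C₂) →
    ∣ C₁ ∩ C₂ ∣ ≡ 27 × IsMaximalClique G C₁ × IsMaximalClique G C₂ × ∣ C₁ ∣ ≡ 29 × ∣ C₂ ∣ ≡ 29
  undominated-cliques {C₁} {C₂} C₁-clique C₂-clique C₁≢C₂ 29≤∣C₁∣ 29≤∣C₂∣ 22≤∣I∣ A↛B B↛A =
    ∣I∣≡27 , maximal₁ , maximal₂ , ∣C₁∣≡29 , ∣C₂∣≡29
    where
    A B I : Subset n
    A = C₁ ─ C₂
    B = C₂ ─ C₁
    I = C₁ ∩ C₂
    ov : OverlappingCliques G A B I
    ov = overlapping-cliques G C₁-clique C₂-clique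
    ∣A∣+∣I∣≡∣C₁∣ : ∣ A ∣ ℕ.+ ∣ I ∣ ≡ ∣ C₁ ∣
    ∣A∣+∣I∣≡∣C₁∣ = ∣─∣+∣∩∣ C₁ C₂
    ∣B∣+∣I∣≡∣C₂∣ : ∣ B ∣ ℕ.+ ∣ I ∣ ≡ ∣ C₂ ∣
    ∣B∣+∣I∣≡∣C₂∣ = trans (cong (λ J → ∣ B ∣ ℕ.+ ∣ J ∣) (∩-comm C₁ C₂)) (∣─∣+∣∩∣ C₂ C₁)
    29≤∣I∣+∣A∣ : 29 ℕ.≤ ∣ I ∣ ℕ.+ ∣ A ∣
    29≤∣I∣+∣A∣ = subst (29 ℕ.≤_) (trans (sym ∣A∣+∣I∣≡∣C₁∣) (ℕP.+-comm ∣ A ∣ ∣ I ∣)) 29≤∣C₁∣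
    29≤∣I∣+∣B∣ : 29 ℕ.≤ ∣ I ∣ ℕ.+ ∣ B ∣
    29≤∣I∣+∣B∣ = subst (29 ℕ.≤_) (trans (sym ∣B∣+∣I∣≡∣C₂∣) (ℕP.+-comm ∣ B ∣ ∣ I ∣)) 29≤∣C₂∣
    A-nonempty : Nonempty A
    A-nonempty with nonempty? A | nonempty? B
    ... | yes A-nonempty | _ = A-nonempty
    ... | no _ | yes (t , t∈B) = let s , s∈A , _ = B↛A t∈B in s , s∈A
    ... | no A-empty | no B-empty = ⊥-elim (C₁≢C₂ (⊆-antisym (Empty─⇒⊆ A-empty) (Empty─⇒⊆ B-empty)))
    B-nonempty : Nonempty B
    B-nonempty = let t , t∈B , _ = A↛B (proj₂ A-nonempty) in t , t∈B
    sizes : ∣ I ∣ ≡ 27 × ∣ A ∣ ≡ 2 × ∣ B ∣ ≡ 2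
    sizes = Overlap.overlap-sizes ov A↛B B↛A A-nonempty 22≤∣I∣ 29≤∣I∣+∣A∣ 29≤∣I∣+∣B∣
    ∣I∣≡27 : ∣ I ∣ ≡ 27
    ∣I∣≡27 = proj₁ sizes
    ∣C₁∣≡29 : ∣ C₁ ∣ ≡ 29
    ∣C₁∣≡29 = trans (sym ∣A∣+∣I∣≡∣C₁∣) (cong₂ ℕ._+_ (proj₁ (proj₂ sizes)) ∣I∣≡27)
    ∣C₂∣≡29 : ∣ C₂ ∣ ≡ 29
    ∣C₂∣≡29 = trans (sym ∣B∣+∣I∣≡∣C₂∣) (cong₂ ℕ._+_ (proj₂ (proj₂ sizes)) ∣I∣≡27)
    maximal₁ : IsMaximalClique G C₁
    maximal₁ = unextendable⇒maximal G C₁-clique λ v∉C₁ v→C₁ →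
      A∪I-unextendable ov A↛B B↛A A-nonempty 22≤∣I∣ 29≤∣I∣+∣A∣ 29≤∣I∣+∣B∣ (v∉C₁ ∘ A∪I⊆C₁) (v→C₁ ∘ A∪I⊆C₁)
      where
      A∪I⊆C₁ : A ∪ I ⊆ C₁
      A∪I⊆C₁ = ∪-⊆ (proj₁ ∘ ∈─⁻ C₁ C₂) (proj₁ ∘ x∈p∩q⁻ C₁ C₂)
    maximal₂ : IsMaximalClique G C₂
    maximal₂ = unextendable⇒maximal G C₂-clique λ v∉C₂ v→C₂ →
      A∪I-unextendable (swap-overlap G ov) B↛A A↛B B-nonempty 22≤∣I∣ 29≤∣I∣+∣B∣ 29≤∣I∣+∣A∣ (v∉C₂ ∘ B∪I⊆C₂) (v→C₂ ∘ B∪I⊆C₂)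
      where
      B∪I⊆C₂ : B ∪ I ⊆ C₂
      B∪I⊆C₂ = ∪-⊆ (proj₁ ∘ ∈─⁻ C₂ C₁) (proj₂ ∘ x∈p∩q⁻ C₁ C₂)

  two-cliques : (C₁ C₂ : Subset n) → IsClique G C₁ → IsClique G C₂ → C₁ ≢ C₂ →
    ∣ C₁ ∣ ≥ 29 → ∣ C₂ ∣ ≥ 29 → ∣ C₁ ∩ C₂ ∣ ≥ 22 →
    HasDominatingVertex G (SymDiff G C₁ C₂)
    ⊎ (∣ C₁ ∩ C₂ ∣ ≡ 27 × IsMaximalClique G C₁ × IsMaximalClique G C₂ × ∣ C₁ ∣ ≡ 29 × ∣ C₂ ∣ ≡ 29)
  two-cliques C₁ C₂ C₁-clique C₂-clique C₁≢C₂ 29≤∣C₁∣ 29≤∣C₂∣ 22≤∣I∣ =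
    dichotomy (someCompleteTo⊎noneCompleteTo G (C₁ ─ C₂) (C₂ ─ C₁)) (someCompleteTo⊎noneCompleteTo G (C₂ ─ C₁) (C₁ ─ C₂))
    where
    open OverlappingCliques (overlapping-cliques G C₁-clique C₂-clique)
    dichotomy : (∃[ s ] (s ∈ C₁ ─ C₂ × CompleteTo G s (C₂ ─ C₁))) ⊎ NoneCompleteTo G (C₁ ─ C₂) (C₂ ─ C₁) →
                (∃[ t ] (t ∈ C₂ ─ C₁ × CompleteTo G t (C₁ ─ C₂))) ⊎ NoneCompleteTo G (C₂ ─ C₁) (C₁ ─ C₂) →
                HasDominatingVertex G (SymDiff G C₁ C₂)
                ⊎ (∣ C₁ ∩ C₂ ∣ ≡ 27 × IsMaximalClique G C₁ × IsMaximalClique G C₂ × ∣ C₁ ∣ ≡ 29 × ∣ C₂ ∣ ≡ 29)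
    dichotomy (inj₁ (s , s∈A , s→B)) _ = inj₁ (dominating-vertex G A-clique s∈A s→B)
    dichotomy (inj₂ _) (inj₁ (t , t∈B , t→A)) =
      inj₁ (subst (HasDominatingVertex G) (∪-comm (C₂ ─ C₁) (C₁ ─ C₂)) (dominating-vertex G B-clique t∈B t→A))
    dichotomy (inj₂ A↛B) (inj₂ B↛A) =
      inj₂ (undominated-cliques C₁-clique C₂-clique C₁≢C₂ 29≤∣C₁∣ 29≤∣C₂∣ 22≤∣I∣ A↛B B↛A)

lemma3p5 : (G : SimpleGraph 1911) → IsSRG G 270 105 27 →
    (C₁ C₂ : Subset 1911) → IsClique G C₁ → IsClique G C₂ → C₁ ≢ C₂ →
    ∣ C₁ ∣ ≥ 29 → ∣ C₂ ∣ ≥ 29 → ∣ C₁ ∩ C₂ ∣ ≥ 22 →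
    (∃[ z ] (z ∈ SymDiff G C₁ C₂ ×
        (∀ {w} → w ∈ SymDiff G C₁ C₂ → w ≢ z → SimpleGraph.Adj G z w)))
    ⊎ (∣ C₁ ∩ C₂ ∣ ≡ 27 × IsMaximalClique G C₁ × IsMaximalClique G C₂
        × ∣ C₁ ∣ ≡ 29 × ∣ C₂ ∣ ≡ 29)
lemma3p5 G srg = Analysis.two-cliques refl G srg
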